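{- Let $F_i(L)$ and $\alpha_i(a)$ be sequences, depending on $L$ and $a$ respectively, for $i=-1,0,1$. If \begin{align*} F_0(L) &= \sum_{a=-\infty}^\infty \alpha_0(a) T_0\left(\begin{array}{c}L\\ a \end{array};q \right), \qquad F_1(L) = \sum_{a=-\infty}^\infty \alpha_1(a) T_1\left(\begin{array}{c}L\\ a \end{array};q \right), \\ F_{ -1}(L) &= \sum_{a=-\infty}^\infty \alpha_{ -1}(a) \left\{T_{ -1}\left(\begin{array}{c}L\\ a \end{array};q \right)+T_{ -1}\left(\begin{array}{c}L\\ a+1 \end{array};q \right)\right\}, \end{align*} then \begin{align*} \sum_{i\geq 0} q^{\frac{i^2}{2}} {L \brack i}_q F_0(i) &= \sum_{a=-\infty}^\infty \alpha_0(a) q^{\frac{a^2}{2}} {2L\brack L-a}_q,\\ (1+q^L)\sum_{i\geq 0} q^{\binom{i}{2}} {L \brack i}_q F_1(i) &= \sum_{a=-\infty}^\infty \alpha_1(a)(1+q^a) q^{\binom{a}{2}} {2L\brack L-a}_q,\\ \sum_{i\geq 0} q^{\binom{i+1}{2}} {L \brack i}_q F_{ -1}(i) &= \sum_{a=-\infty}^\infty \alpha_{ -1}(a) q^{\binom{a+1}{2}} {2L+1 \brack L-a}_q. \end{align*}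
   Context: Notation: $(a;q)_n=(1-a)(1-aq)\cdots(1-aq^{n-1})$ with $1/(q;q)_n=0$ for $n<0$. The $q$-binomial coefficient is ${m+n\brack m}_q=\frac{(q;q)_{m+n}}{(q;q)_m(q;q)_n}$ for $m,n\geq 0$ and $0$ otherwise. The $q$-trinomial coefficient is $\left(\begin{array}{c}L,\, b\\ a \end{array};q\right)_2 = \sum_{n\geq 0} q^{n(n+b)} \frac{(q;q)_L}{(q;q)_n(q;q)_{n+a}(q;q)_{L-2n-a}}$, and for an integer $n$, $T_n\left(\begin{array}{c}L\\ a\end{array};q\right) = q^{(L(L-n)-a(a-n))/2}\left(\begin{array}{c}L,\, a-n\\ a \end{array};1/q\right)_2$. -}

module Defs where

open import Level using (Level)
open import Algebra.Bundles using (CommutativeRing)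
open import Data.Nat as ℕ using (ℕ; zero; suc)
open import Data.Integer as ℤ using (ℤ; +_; -[1+_])

-- Everything is stated in an arbitrary commutative ring R containing an
-- element s playing the role of q^(1/2), together with an inverse t of s
-- (so q = s*s and 1/q = t*t).  Half-integer powers of q are integer
-- powers of s.

module _ {c ℓ : Level} (R : CommutativeRing c ℓ) where
  open CommutativeRing R

  pow : Carrier → ℕ → Carrier
  pow x zero    = 1#
  pow x (suc n) = x * pow x n

  sumN : ℕ → (ℕ → Carrier) → Carrier
  sumN zero    f = 0#
  sumN (suc n) f = sumN n f + f n

  sumZ : ℕ → (ℤ → Carrier) → Carrier
  sumZ N f = sumN (suc (N ℕ.+ N)) (λ j → f ((+ j) ℤ.- (+ N)))

  gbin : Carrier → ℕ → ℕ → Carrier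
  gbin x zero    zero    = 1#
  gbin x zero    (suc k) = 0#
  gbin x (suc n) zero    = 1#
  gbin x (suc n) (suc k) = gbin x n k + pow x (suc k) * gbin x n (suc k)

  gbinZ : Carrier → ℕ → ℤ → Carrier
  gbinZ x n (+ k)    = gbin x n k
  gbinZ x n -[1+ k ] = 0#

  module _ (s t : Carrier) where
    spow : ℤ → Carrier
    spow (+ n)    = pow s n
    spow -[1+ n ] = pow t (suc n)

    qpow : ℤ → Carrier
    qpow k = spow ((+ 2) ℤ.* k)

    qinvpow : ℤ → Carrier
    qinvpow k = spow (ℤ.- ((+ 2) ℤ.* k))

    -- q-trinomial coefficient (L, b ; a ; p)_2 in base p, where bp k = p^k:
    --   Σ_{n≥0} p^{n(n+b)} (p;p)_L / ((p;p)_n (p;p)_{n+a} (p;p)_{L-2n-a})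
    -- with the multinomial written as [L choose n]_p [L-n choose n+a]_p
    -- (which vanishes exactly when n+a<0 or L-2n-a<0); terms vanish for n>L.
    trinom : (ℤ → Carrier) → ℕ → ℤ → ℤ → Carrier
    trinom bp L b a =
      sumN (suc L) (λ n →
        bp ((+ n) ℤ.* ((+ n) ℤ.+ b))
        * (gbin (bp (+ 1)) L n * gbinZ (bp (+ 1)) (L ℕ.∸ n) ((+ n) ℤ.+ a)))

    T : ℤ → ℕ → ℤ → Carrier
    T n L a =
      spow ((+ L) ℤ.* ((+ L) ℤ.- n) ℤ.- a ℤ.* (a ℤ.- n))
      * trinom qinvpow L (a ℤ.- n) a

-- Inserting the expansions of F_c in terms of T_c and exchanging the sums reduces each identity to
-- the evaluation, for fixed a, of Σ_i q^{i(i-c)/2} [L,i] T_c(i; a).  Converting the 1/q-binomials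
-- of T_c to base q writes T_c(i; a) as a sum of q-trinomial coefficients that depends only on
-- w = |a|; reindexing the resulting double sum and applying q-Vandermonde collapses it to
-- Σ_N q^{(N(N-c) + (N+w)(N+w-c))/2} [L,N] [L,N+w], which a second application of q-Vandermonde
-- evaluates as a single binomial [2L, L-w] (for c = -1 after pairing w with w+1 to form
-- [2L+1, L-w]; for c = 1 after multiplying by 1 + q^L and using both Pascal rules).

module Submission where

open import Defs
open import Level using (Level)
open import Algebra.Bundles using (CommutativeRing)
open import Data.Nat as ℕ using (ℕ; zero; suc; _≤_; _<_; _∸_; z≤n; s≤s)
import Data.Nat.Properties as ℕP
open import Data.Integer as ℤ using (ℤ; +_; -[1+_]; _⊖_)
import Data.Integer.Properties as ℤP
open import Data.Product using (_×_; _,_)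
open import Data.Sum using (_⊎_; inj₁; inj₂)
open import Function using (_∘_)
open import Relation.Binary.PropositionalEquality as ≡ using (_≡_)

import Data.Nat.Tactic.RingSolver as ℕ-Solver
import Data.Integer.Tactic.RingSolver as ℤ-Solver

n∸k≡1+[n∸1+k] : ∀ {k n} → k < n → n ∸ k ≡ suc (n ∸ suc k)
n∸k≡1+[n∸1+k] {k} {suc n} (s≤s k≤n) = ℕP.+-∸-assoc 1 k≤n

2+k+[n∸1+k]≡[n∸k]+1+k : ∀ {k n} → k < n → 2 ℕ.+ k ℕ.+ (n ∸ suc k) ≡ (n ∸ k) ℕ.+ suc k
2+k+[n∸1+k]≡[n∸k]+1+k {k} {suc n} (s≤s k≤n) =
  ≡.trans (ring k (n ∸ k)) (≡.cong (ℕ._+ suc k) (≡.sym (ℕP.+-∸-assoc 1 k≤n)))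
  where
  ring : ∀ k d → 2 ℕ.+ k ℕ.+ d ≡ suc d ℕ.+ suc k
  ring = ℕ-Solver.solve-∀

j+[1+m∸j]*[k∸j]≡k+[m∸j]*[k∸j] : ∀ {j m k} → j ≤ m → j ≤ k → j ℕ.+ (suc m ∸ j) ℕ.* (k ∸ j) ≡ k ℕ.+ (m ∸ j) ℕ.* (k ∸ j)
j+[1+m∸j]*[k∸j]≡k+[m∸j]*[k∸j] {j} j≤m j≤k with ℕP.m≤n⇒∃[o]m+o≡n j≤m | ℕP.m≤n⇒∃[o]m+o≡n j≤k
... | d , ≡.refl | e , ≡.refl
  rewrite ≡.sym (ℕP.+-suc j d) | ℕP.m+n∸m≡n j (suc d) | ℕP.m+n∸m≡n j d | ℕP.m+n∸m≡n j e = ring j d e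
  where
  ring : ∀ j d e → j ℕ.+ suc d ℕ.* e ≡ j ℕ.+ e ℕ.+ d ℕ.* e
  ring = ℕ-Solver.solve-∀

[w+k]∸[k∸n]≡n+w : ∀ {n k} w → n ≤ k → (w ℕ.+ k) ∸ (k ∸ n) ≡ n ℕ.+ w
[w+k]∸[k∸n]≡n+w {n} w n≤k with ℕP.m≤n⇒∃[o]m+o≡n n≤k
... | d , ≡.refl rewrite ℕP.m+n∸m≡n n d = ≡.trans (≡.cong (_∸ d) (ring w n d)) (ℕP.m+n∸n≡m (n ℕ.+ w) d)
  where
  ring : ∀ w n d → w ℕ.+ (n ℕ.+ d) ≡ n ℕ.+ w ℕ.+ d
  ring = ℕ-Solver.solve-∀

[k∸n]+[n+w]≡w+k : ∀ {n k} w → n ≤ k → (k ∸ n) ℕ.+ (n ℕ.+ w) ≡ w ℕ.+ k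
[k∸n]+[n+w]≡w+k {n} w n≤k with ℕP.m≤n⇒∃[o]m+o≡n n≤k
... | d , ≡.refl rewrite ℕP.m+n∸m≡n n d = ring d n w
  where
  ring : ∀ d n w → d ℕ.+ (n ℕ.+ w) ≡ w ℕ.+ (n ℕ.+ d)
  ring = ℕ-Solver.solve-∀

[n+n]∸[n∸w]≡n+w : ∀ {w n} → w ≤ n → (n ℕ.+ n) ∸ (n ∸ w) ≡ n ℕ.+ w
[n+n]∸[n∸w]≡n+w {w} w≤n with ℕP.m≤n⇒∃[o]m+o≡n w≤n
... | d , ≡.refl rewrite ℕP.m+n∸m≡n w d = ≡.trans (≡.cong (_∸ d) (reorder w d)) (ℕP.m+n∸n≡m (w ℕ.+ d ℕ.+ w) d)
  where
  reorder : ∀ w d → w ℕ.+ d ℕ.+ (w ℕ.+ d) ≡ w ℕ.+ d ℕ.+ w ℕ.+ d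
  reorder = ℕ-Solver.solve-∀

2*n≡n+n : ∀ n → 2 ℕ.* n ≡ n ℕ.+ n
2*n≡n+n n = ≡.cong (n ℕ.+_) (ℕP.+-identityʳ n)

1+2*n≡n+[1+n] : ∀ n → suc (2 ℕ.* n) ≡ n ℕ.+ suc n
1+2*n≡n+[1+n] n = ≡.trans (≡.cong suc (2*n≡n+n n)) (≡.sym (ℕP.+-suc n n))

+[m∸n]≡+m-+n : ∀ {m n} → n ≤ m → + (m ∸ n) ≡ + m ℤ.- + n
+[m∸n]≡+m-+n {m} {n} n≤m = ≡.trans (≡.sym (ℤP.≤-⊖ n≤m)) (≡.sym (ℤP.m-n≡m⊖n m n))

+m-+n≡-[1+n∸1+m] : ∀ {m n} → m < n → + m ℤ.- + n ≡ -[1+ (n ∸ suc m) ]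
+m-+n≡-[1+n∸1+m] {m} {n} m<n =
  ≡.trans (ℤP.m-n≡m⊖n m n) (≡.trans (ℤP.⊖-< m<n) (≡.cong (ℤ.-_ ∘ +_) (n∸k≡1+[n∸1+k] m<n)))

+n+-[1+u]≡-[1+u∸n] : ∀ {n u} → n ≤ u → + n ℤ.+ -[1+ u ] ≡ -[1+ (u ∸ n) ]
+n+-[1+u]≡-[1+u∸n] {zero}  {u}     _         = ≡.refl
+n+-[1+u]≡-[1+u∸n] {suc n} {suc u} (s≤s n≤u) = ≡.trans (ℤP.[1+m]⊖[1+n]≡m⊖n n (suc u)) (+n+-[1+u]≡-[1+u∸n] n≤u)

+[1+u+m]+-[1+u]≡+m : ∀ u m → + (suc u ℕ.+ m) ℤ.+ -[1+ u ] ≡ + m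
+[1+u+m]+-[1+u]≡+m u m =
  ≡.trans (≡.cong ((suc u ℕ.+ m) ⊖_) (≡.sym (ℕP.+-identityʳ (suc u)))) (ℤP.+-cancelˡ-⊖ (suc u) m 0)

-- s^ (weight c x) is q^{x(x-c)/2}.
weight : ℤ → ℤ → ℤ
weight c x = x ℤ.* (x ℤ.- c)

module _ {c ℓ : Level} (R : CommutativeRing c ℓ) where
  open CommutativeRing R
  open import Relation.Binary.Reasoning.Setoid setoid
  open import Algebra.Solver.Ring.NaturalCoefficients.Default commutativeSemiring

  ≡⇒≈ : ∀ {x y} → x ≡ y → x ≈ y
  ≡⇒≈ ≡.refl = refl

  x*0≈0 : ∀ {x y} → y ≈ 0# → x * y ≈ 0#
  x*0≈0 y≈0 = trans (*-congˡ y≈0) (zeroʳ _)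

  0*y≈0 : ∀ {x y} → x ≈ 0# → x * y ≈ 0#
  0*y≈0 x≈0 = trans (*-congʳ x≈0) (zeroˡ _)

  sumN-cong : ∀ n {f g : ℕ → Carrier} → (∀ i → i < n → f i ≈ g i) → sumN R n f ≈ sumN R n g
  sumN-cong zero    f≈g = refl
  sumN-cong (suc n) f≈g = +-cong (sumN-cong n (λ i i<n → f≈g i (ℕP.m<n⇒m<1+n i<n))) (f≈g n ℕP.≤-refl)

  sumN-zero : ∀ n {f : ℕ → Carrier} → (∀ i → i < n → f i ≈ 0#) → sumN R n f ≈ 0#
  sumN-zero zero    f≈0 = refl
  sumN-zero (suc n) f≈0 =
    trans (+-cong (sumN-zero n (λ i i<n → f≈0 i (ℕP.m<n⇒m<1+n i<n))) (f≈0 n ℕP.≤-refl)) (+-identityˡ 0#)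

  sumN-+ : ∀ n (f g : ℕ → Carrier) → sumN R n (λ i → f i + g i) ≈ sumN R n f + sumN R n g
  sumN-+ zero    f g = sym (+-identityˡ 0#)
  sumN-+ (suc n) f g = begin
    sumN R n (λ i → f i + g i) + (f n + g n)     ≈⟨ +-congʳ (sumN-+ n f g) ⟩
    (sumN R n f + sumN R n g) + (f n + g n)     ≈⟨ solve 4 (λ a b c d → (a :+ b) :+ (c :+ d) := (a :+ c) :+ (b :+ d)) refl _ _ _ _ ⟩
    (sumN R n f + f n) + (sumN R n g + g n)     ∎

  sumN-*ˡ : ∀ n x (f : ℕ → Carrier) → x * sumN R n f ≈ sumN R n (λ i → x * f i)
  sumN-*ˡ zero    x f = zeroʳ x
  sumN-*ˡ (suc n) x f = trans (distribˡ x _ _) (+-congʳ (sumN-*ˡ n x f))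

  sumN-sucˡ : ∀ n (f : ℕ → Carrier) → sumN R (suc n) f ≈ f 0 + sumN R n (λ i → f (suc i))
  sumN-sucˡ zero    f = trans (+-identityˡ _) (sym (+-identityʳ _))
  sumN-sucˡ (suc n) f = trans (+-congʳ (sumN-sucˡ n f)) (+-assoc _ _ _)

  sumN-swap : ∀ n m (f : ℕ → ℕ → Carrier) →
    sumN R n (λ i → sumN R m (f i)) ≈ sumN R m (λ j → sumN R n (λ i → f i j))
  sumN-swap zero    m f = sym (sumN-zero m (λ _ _ → refl))
  sumN-swap (suc n) m f = trans (+-congʳ (sumN-swap n m f)) (sym (sumN-+ m _ _))

  sumN-reverse : ∀ n (f : ℕ → Carrier) → sumN R (suc n) f ≈ sumN R (suc n) (λ j → f (n ∸ j))
  sumN-reverse zero    f = refl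
  sumN-reverse (suc n) f = begin
    sumN R (suc n) f + f (suc n)                  ≈⟨ +-comm _ _ ⟩
    f (suc n) + sumN R (suc n) f                  ≈⟨ +-congˡ (sumN-reverse n f) ⟩
    f (suc n) + sumN R (suc n) (λ j → f (n ∸ j))  ≈⟨ sym (sumN-sucˡ (suc n) _) ⟩
    sumN R (suc (suc n)) (λ j → f (suc n ∸ j))    ∎

  sumN-extend : ∀ {n N} (f : ℕ → Carrier) → n ≤ N → (∀ i → n ≤ i → f i ≈ 0#) → sumN R N f ≈ sumN R n f
  sumN-extend {n} f n≤N f≈0 with ℕP.m≤n⇒∃[o]m+o≡n n≤N
  ... | d , ≡.refl = go d
    where
    go : ∀ d → sumN R (n ℕ.+ d) f ≈ sumN R n f
    go zero    = ≡⇒≈ (≡.cong (λ k → sumN R k f) (ℕP.+-identityʳ n))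
    go (suc d) = begin
      sumN R (n ℕ.+ suc d) f            ≡⟨ ≡.cong (λ k → sumN R k f) (ℕP.+-suc n d) ⟩
      sumN R (n ℕ.+ d) f + f (n ℕ.+ d)  ≈⟨ +-cong (go d) (f≈0 _ (ℕP.m≤m+n n d)) ⟩
      sumN R n f + 0#                   ≈⟨ +-identityʳ _ ⟩
      sumN R n f                        ∎

  sumN-support : ∀ n m (f : ℕ → Carrier) → (∀ i → n ≤ i → f i ≈ 0#) → (∀ i → m ≤ i → f i ≈ 0#) →
    sumN R n f ≈ sumN R m f
  sumN-support n m f f≈0₁ f≈0₂ with ℕP.≤-total n m
  ... | inj₁ n≤m = sym (sumN-extend f n≤m f≈0₁)
  ... | inj₂ m≤n = sumN-extend f m≤n f≈0₂

  sumN-drop : ∀ d n (f : ℕ → Carrier) → (∀ i → i < d → f i ≈ 0#) → sumN R (d ℕ.+ n) f ≈ sumN R n (λ j → f (d ℕ.+ j))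
  sumN-drop zero    n f f≈0 = refl
  sumN-drop (suc d) n f f≈0 = begin
    sumN R (suc (d ℕ.+ n)) f                         ≈⟨ sumN-sucˡ (d ℕ.+ n) f ⟩
    f 0 + sumN R (d ℕ.+ n) (λ i → f (suc i))         ≈⟨ +-cong (f≈0 0 (s≤s z≤n)) (sumN-drop d n (λ i → f (suc i)) (λ i i<d → f≈0 (suc i) (s≤s i<d))) ⟩
    0# + sumN R n (λ j → f (suc d ℕ.+ j))            ≈⟨ +-identityˡ _ ⟩
    sumN R n (λ j → f (suc d ℕ.+ j))                 ∎

  sumN-translate : ∀ n d (f : ℕ → Carrier) → (∀ i → i < d → f i ≈ 0#) → (∀ i → n ≤ i → f i ≈ 0#) →
    sumN R n f ≈ sumN R n (λ j → f (d ℕ.+ j))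
  sumN-translate n d f f≈0ˡ f≈0ʳ =
    trans (sym (sumN-extend f (ℕP.m≤n+m n d) f≈0ʳ)) (sumN-drop d n f f≈0ˡ)

  sumZ-step : ∀ M (f : ℤ → Carrier) → sumZ R (suc M) f ≈ f -[1+ M ] + sumZ R M f + f (+ suc M)
  sumZ-step M f = +-cong inner (≡⇒≈ (≡.cong f top))
    where
    g : ℕ → Carrier
    g j = f (+ j ℤ.- + suc M)
    shift : ∀ j → + suc j ℤ.- + suc M ≡ + j ℤ.- + M
    shift j = ≡.trans (ℤP.m-n≡m⊖n (suc j) (suc M))
                (≡.trans (ℤP.[1+m]⊖[1+n]≡m⊖n j M) (≡.sym (ℤP.m-n≡m⊖n j M)))
    top : + (suc M ℕ.+ suc M) ℤ.- + suc M ≡ + suc M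
    top = ≡.trans (ℤP.m-n≡m⊖n (suc M ℕ.+ suc M) (suc M))
            (≡.trans (ℤP.⊖-≥ (ℕP.m≤m+n (suc M) (suc M))) (≡.cong +_ (ℕP.m+n∸m≡n (suc M) (suc M))))
    inner : sumN R (suc M ℕ.+ suc M) g ≈ f -[1+ M ] + sumZ R M f
    inner = begin
      sumN R (suc (M ℕ.+ suc M)) g                                ≈⟨ sumN-sucˡ (M ℕ.+ suc M) g ⟩
      g 0 + sumN R (M ℕ.+ suc M) (λ j → g (suc j))              ≈⟨ +-congˡ (sumN-cong (M ℕ.+ suc M) (λ j _ → ≡⇒≈ (≡.cong f (shift j)))) ⟩
      g 0 + sumN R (M ℕ.+ suc M) (λ j → f (+ j ℤ.- + M))        ≡⟨ ≡.cong (λ k → g 0 + sumN R k (λ j → f (+ j ℤ.- + M))) (ℕP.+-suc M M) ⟩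
      f -[1+ M ] + sumZ R M f                                    ∎

  sumZ-extend : ∀ {N M} (f : ℤ → Carrier) → N ≤ M →
    (∀ j → N ≤ j → f (+ suc j) ≈ 0#) → (∀ j → N ≤ j → f -[1+ j ] ≈ 0#) → sumZ R M f ≈ sumZ R N f
  sumZ-extend {N} f N≤M f≈0⁺ f≈0⁻ with ℕP.m≤n⇒∃[o]m+o≡n N≤M
  ... | d , ≡.refl = go d
    where
    go : ∀ d → sumZ R (N ℕ.+ d) f ≈ sumZ R N f
    go zero    = ≡⇒≈ (≡.cong (λ k → sumZ R k f) (ℕP.+-identityʳ N))
    go (suc d) = begin
      sumZ R (N ℕ.+ suc d) f                                               ≡⟨ ≡.cong (λ k → sumZ R k f) (ℕP.+-suc N d) ⟩
      sumZ R (suc (N ℕ.+ d)) f                                             ≈⟨ sumZ-step (N ℕ.+ d) f ⟩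
      f -[1+ N ℕ.+ d ] + sumZ R (N ℕ.+ d) f + f (+ suc (N ℕ.+ d))          ≈⟨ +-cong (+-cong (f≈0⁻ _ (ℕP.m≤m+n N d)) (go d)) (f≈0⁺ _ (ℕP.m≤m+n N d)) ⟩
      0# + sumZ R N f + 0#                                                 ≈⟨ trans (+-identityʳ _) (+-identityˡ _) ⟩
      sumZ R N f                                                           ∎

  sumN-sumZ-exchange : ∀ L (ω : ℕ → Carrier) (K : ℕ → ℤ → Carrier) (α : ℤ → Carrier) (F : ℕ → Carrier) →
    (∀ i → F i ≈ sumZ R (suc i) (λ a → α a * K i a)) → (∀ i a → suc i < ℤ.∣ a ∣ → K i a ≈ 0#) →
    sumN R (suc L) (λ i → ω i * F i) ≈ sumZ R (suc L) (λ a → α a * sumN R (suc L) (λ i → ω i * K i a))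
  sumN-sumZ-exchange L ω K α F F≈ K≈0 = begin
    sumN R (suc L) (λ i → ω i * F i)                                   ≈⟨ sumN-cong (suc L) expand ⟩
    sumN R (suc L) (λ i → sumN R M (λ j → ω i * (α (a j) * K i (a j))))  ≈⟨ sumN-swap (suc L) M _ ⟩
    sumN R M (λ j → sumN R (suc L) (λ i → ω i * (α (a j) * K i (a j))))  ≈⟨ sumN-cong M (λ j _ → sym (trans (sumN-*ˡ (suc L) _ _)
                                                                            (sumN-cong (suc L) (λ i _ → solve 3 (λ x w k → x :* (w :* k) := w :* (x :* k)) refl _ _ _)))) ⟩
    sumZ R (suc L) (λ a → α a * sumN R (suc L) (λ i → ω i * K i a))     ∎
    where
    M = suc (suc L ℕ.+ suc L)
    a = λ j → + j ℤ.- + suc L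
    expand : ∀ i → i < suc L → ω i * F i ≈ sumN R M (λ j → ω i * (α (a j) * K i (a j)))
    expand i (s≤s i≤L) = trans (*-congˡ (trans (F≈ i) (sym (sumZ-extend (λ a → α a * K i a) (s≤s i≤L)
                                  (λ j i<j → x*0≈0 (K≈0 i (+ suc j) (s≤s i<j)))
                                  (λ j i<j → x*0≈0 (K≈0 i -[1+ j ] (s≤s i<j)))))))
                               (sumN-*ˡ M _ _)

  pow-+ : ∀ x m n → pow R x (m ℕ.+ n) ≈ pow R x m * pow R x n
  pow-+ x zero    n = sym (*-identityˡ _)
  pow-+ x (suc m) n = trans (*-congˡ (pow-+ x m n)) (sym (*-assoc _ _ _))

  pow-* : ∀ x m n → pow R x (m ℕ.* n) ≈ pow R (pow R x m) n
  pow-* x m zero    = ≡⇒≈ (≡.cong (pow R x) (ℕP.*-zeroʳ m))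
  pow-* x m (suc n) = begin
    pow R x (m ℕ.* suc n)              ≡⟨ ≡.cong (pow R x) (ℕP.*-suc m n) ⟩
    pow R x (m ℕ.+ m ℕ.* n)            ≈⟨ pow-+ x m (m ℕ.* n) ⟩
    pow R x m * pow R x (m ℕ.* n)      ≈⟨ *-congˡ (pow-* x m n) ⟩
    pow R x m * pow R (pow R x m) n    ∎

  gbin-cong : ∀ x {n n′ k k′} → n ≡ n′ → k ≡ k′ → gbin R x n k ≈ gbin R x n′ k′
  gbin-cong x ≡.refl ≡.refl = refl

  gbin-vanish : ∀ x {n k} → n < k → gbin R x n k ≈ 0#
  gbin-vanish x {zero}  {suc k} _         = refl
  gbin-vanish x {suc n} {suc k} (s≤s n<k) =
    trans (+-cong (gbin-vanish x n<k) (x*0≈0 (gbin-vanish x (ℕP.m<n⇒m<1+n n<k)))) (+-identityˡ 0#)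

  gbin-zero : ∀ x n → gbin R x n 0 ≈ 1#
  gbin-zero x zero    = refl
  gbin-zero x (suc n) = refl

  gbin-diag : ∀ x n → gbin R x n n ≈ 1#
  gbin-diag x zero    = refl
  gbin-diag x (suc n) =
    trans (+-cong (gbin-diag x n) (x*0≈0 (gbin-vanish x (ℕP.n<1+n n)))) (+-identityʳ 1#)

  prev : (ℕ → Carrier) → ℕ → Carrier
  prev f zero    = 0#
  prev f (suc k) = f k

  gbin-pascal : ∀ x n k → gbin R x (suc n) k ≈ prev (gbin R x n) k + pow R x k * gbin R x n k
  gbin-pascal x n zero    = sym (trans (+-identityˡ _) (trans (*-identityˡ _) (gbin-zero x n)))
  gbin-pascal x n (suc k) = refl

  gbin-pascal′ : ∀ x n k → gbin R x (suc n) (suc k) ≈ gbin R x n (suc k) + pow R x (n ∸ k) * gbin R x n k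
  gbin-pascal′ x zero k = begin
    gbin R x 0 k + pow R x (suc k) * 0#      ≈⟨ trans (+-congˡ (zeroʳ _)) (+-identityʳ _) ⟩
    gbin R x 0 k                             ≈⟨ sym (trans (+-identityˡ _) (*-identityˡ _)) ⟩
    0# + 1# * gbin R x 0 k                   ≡⟨ ≡.cong (λ e → 0# + pow R x e * gbin R x 0 k) (≡.sym (ℕP.0∸n≡0 k)) ⟩
    0# + pow R x (0 ∸ k) * gbin R x 0 k      ∎
  gbin-pascal′ x (suc n) zero = begin
    1# + pow R x 1 * gbin R x (suc n) 1                          ≈⟨ +-congˡ (*-congˡ (gbin-pascal′ x n 0)) ⟩
    1# + pow R x 1 * (gbin R x n 1 + pow R x n * gbin R x n 0)  ≈⟨ +-congˡ (*-congˡ (+-congˡ (*-congˡ (gbin-zero x n)))) ⟩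
    1# + pow R x 1 * (gbin R x n 1 + pow R x n * 1#)            ≈⟨ solve 3 (λ x g p → con 1 :+ (x :* con 1) :* (g :+ p :* con 1)
                                                                      := (con 1 :+ (x :* con 1) :* g) :+ (x :* p) :* con 1) refl x _ _ ⟩
    (1# + pow R x 1 * gbin R x n 1) + pow R x (suc n) * 1#      ≈⟨ +-congʳ (+-congʳ (sym (gbin-zero x n))) ⟩
    gbin R x (suc n) 1 + pow R x (suc n) * gbin R x (suc n) 0   ∎
  gbin-pascal′ x (suc n) (suc k) = begin
    gbin R x (suc n) (suc k) + pow R x (2 ℕ.+ k) * gbin R x (suc n) (2 ℕ.+ k)
      ≈⟨ +-cong (gbin-pascal′ x n k) (*-congˡ (gbin-pascal′ x n (suc k))) ⟩
    (A + x[n-k] * B) + x[k+2] * (C + x[n-k-1] * A)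
      ≈⟨ solve 6 (λ A B C p q r → (A :+ p :* B) :+ q :* (C :+ r :* A) := (A :+ q :* C) :+ p :* B :+ (q :* r) :* A) refl A B C x[n-k] x[k+2] x[n-k-1] ⟩
    (A + x[k+2] * C) + x[n-k] * B + (x[k+2] * x[n-k-1]) * A
      ≈⟨ +-congˡ exponents ⟩
    (A + x[k+2] * C) + x[n-k] * B + (x[n-k] * pow R x (suc k)) * A
      ≈⟨ solve 5 (λ D p B X A → D :+ p :* B :+ (p :* X) :* A := D :+ p :* (B :+ X :* A)) refl _ x[n-k] B (pow R x (suc k)) A ⟩
    (A + x[k+2] * C) + x[n-k] * (B + pow R x (suc k) * A)  ∎
    where
    A = gbin R x n (suc k)
    B = gbin R x n k
    C = gbin R x n (2 ℕ.+ k)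
    x[n-k] = pow R x (n ∸ k)
    x[k+2] = pow R x (2 ℕ.+ k)
    x[n-k-1] = pow R x (n ∸ suc k)
    exponents : (x[k+2] * x[n-k-1]) * A ≈ (x[n-k] * pow R x (suc k)) * A
    exponents with ℕP.<-≤-connex k n
    ... | inj₁ k<n = *-congʳ (begin
      x[k+2] * x[n-k-1]                    ≈⟨ sym (pow-+ x (2 ℕ.+ k) (n ∸ suc k)) ⟩
      pow R x (2 ℕ.+ k ℕ.+ (n ∸ suc k))    ≡⟨ ≡.cong (pow R x) (2+k+[n∸1+k]≡[n∸k]+1+k k<n) ⟩
      pow R x ((n ∸ k) ℕ.+ suc k)          ≈⟨ pow-+ x (n ∸ k) (suc k) ⟩
      x[n-k] * pow R x (suc k)             ∎)
    ... | inj₂ n≤k = trans (x*0≈0 A≈0) (sym (x*0≈0 A≈0))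
      where A≈0 = gbin-vanish x (s≤s n≤k)

  gbin-pascal′-prev : ∀ x n k → gbin R x (suc n) k ≈ gbin R x n k + pow R x (suc n ∸ k) * prev (gbin R x n) k
  gbin-pascal′-prev x n zero    = sym (trans (+-congˡ (zeroʳ _)) (trans (+-identityʳ _) (gbin-zero x n)))
  gbin-pascal′-prev x n (suc k) = gbin-pascal′ x n k

  gbin-sym : ∀ x a b → gbin R x (a ℕ.+ b) a ≈ gbin R x (a ℕ.+ b) b
  gbin-sym x zero    b       = trans (gbin-zero x b) (sym (gbin-diag x b))
  gbin-sym x (suc a) zero    =
    trans (gbin-cong x {k = suc a} (ℕP.+-identityʳ (suc a)) ≡.refl) (trans (gbin-diag x (suc a)) (sym (gbin-zero x (suc a ℕ.+ 0))))
  gbin-sym x (suc a) (suc b) = begin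
    gbin R x (a ℕ.+ suc b) a + pow R x (suc a) * gbin R x (a ℕ.+ suc b) (suc a)
      ≈⟨ +-cong (gbin-sym x a (suc b)) (*-congˡ swapped) ⟩
    gbin R x (a ℕ.+ suc b) (suc b) + pow R x (suc a) * gbin R x (a ℕ.+ suc b) b
      ≡⟨ ≡.cong (λ e → gbin R x (a ℕ.+ suc b) (suc b) + pow R x e * gbin R x (a ℕ.+ suc b) b) (≡.sym (≡.trans (≡.cong (_∸ b) a+1+b) (ℕP.m+n∸n≡m (suc a) b))) ⟩
    gbin R x (a ℕ.+ suc b) (suc b) + pow R x ((a ℕ.+ suc b) ∸ b) * gbin R x (a ℕ.+ suc b) b
      ≈⟨ sym (gbin-pascal′ x (a ℕ.+ suc b) b) ⟩
    gbin R x (suc (a ℕ.+ suc b)) (suc b) ∎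
    where
    a+1+b = ℕP.+-suc a b
    swapped : gbin R x (a ℕ.+ suc b) (suc a) ≈ gbin R x (a ℕ.+ suc b) b
    swapped = trans (gbin-cong x a+1+b ≡.refl) (trans (gbin-sym x (suc a) b) (gbin-cong x (≡.sym a+1+b) ≡.refl))

  gbin-centre-sym : ∀ x {L w} n → w ≤ L → gbin R x (L ℕ.+ n) (L ∸ w) ≈ gbin R x (L ℕ.+ n) (n ℕ.+ w)
  gbin-centre-sym x {L} {w} n w≤L = begin
    gbin R x (L ℕ.+ n) (L ∸ w)                     ≈⟨ gbin-cong x (≡.sym total) ≡.refl ⟩
    gbin R x ((L ∸ w) ℕ.+ (n ℕ.+ w)) (L ∸ w)       ≈⟨ gbin-sym x (L ∸ w) (n ℕ.+ w) ⟩
    gbin R x ((L ∸ w) ℕ.+ (n ℕ.+ w)) (n ℕ.+ w)     ≈⟨ gbin-cong x total ≡.refl ⟩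
    gbin R x (L ℕ.+ n) (n ℕ.+ w)                   ∎
    where
    total : (L ∸ w) ℕ.+ (n ℕ.+ w) ≡ L ℕ.+ n
    total = ≡.trans (≡.cong ((L ∸ w) ℕ.+_) (ℕP.+-comm n w))
              (≡.trans (≡.sym (ℕP.+-assoc (L ∸ w) w n)) (≡.cong (ℕ._+ n) (ℕP.m∸n+n≡m w≤L)))

  gbin-lower-step : ∀ x n a b →
    gbin R x n (suc a) * gbin R x (n ∸ a) (suc b) ≈
    gbin R x n (suc a) * gbin R x (n ∸ suc a) b + pow R x (suc b) * (gbin R x n (suc a) * gbin R x (n ∸ suc a) (suc b))
  gbin-lower-step x n a b with ℕP.<-≤-connex a n
  ... | inj₁ a<n = begin
    G * gbin R x (n ∸ a) (suc b)                          ≡⟨ ≡.cong (λ m → G * gbin R x m (suc b)) (n∸k≡1+[n∸1+k] a<n) ⟩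
    G * (gbin R x m b + pow R x (suc b) * gbin R x m (suc b))
      ≈⟨ solve 4 (λ G B p C → G :* (B :+ p :* C) := G :* B :+ p :* (G :* C)) refl G _ _ _ ⟩
    G * gbin R x m b + pow R x (suc b) * (G * gbin R x m (suc b)) ∎
    where
    G = gbin R x n (suc a)
    m = n ∸ suc a
  ... | inj₂ n≤a = trans (0*y≈0 G≈0) (sym (trans (+-cong (0*y≈0 G≈0) (x*0≈0 (0*y≈0 G≈0))) (+-identityˡ 0#)))
    where G≈0 = gbin-vanish x (s≤s n≤a)

  -- Both sides are the q-trinomial coefficient; they satisfy the same three-term Pascal recursion in n.
  gbin-trinomial : ∀ x n a b → gbin R x n a * gbin R x (n ∸ a) b ≈ gbin R x n (a ℕ.+ b) * gbin R x (a ℕ.+ b) a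
  gbin-trinomial x zero    zero    zero    = refl
  gbin-trinomial x zero    zero    (suc b) = trans (zeroʳ _) (sym (zeroˡ _))
  gbin-trinomial x zero    (suc a) b       = trans (zeroˡ _) (sym (zeroˡ _))
  gbin-trinomial x (suc n) zero    b       = trans (*-identityˡ _) (sym (trans (*-congˡ (gbin-zero x b)) (*-identityʳ _)))
  gbin-trinomial x (suc n) (suc a) zero    = trans (*-congˡ (gbin-zero x (n ∸ a))) (sym (*-cong
    (gbin-cong x {n = suc n} ≡.refl a+0) (trans (gbin-cong x {k = suc a} a+0 ≡.refl) (gbin-diag x (suc a)))))
    where a+0 = ℕP.+-identityʳ (suc a)
  gbin-trinomial x (suc n) (suc a) (suc b) = begin
    (gbin R x n a + pa * gbin R x n (suc a)) * gbin R x (n ∸ a) (suc b)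
      ≈⟨ solve 4 (λ A p B C → (A :+ p :* B) :* C := A :* C :+ p :* (B :* C)) refl _ pa _ _ ⟩
    M a (suc b) + pa * (gbin R x n (suc a) * gbin R x (n ∸ a) (suc b))
      ≈⟨ +-congˡ (*-congˡ (gbin-lower-step x n a b)) ⟩
    M a (suc b) + pa * (M (suc a) b + pb * M (suc a) (suc b))
      ≈⟨ +-cong (gbin-trinomial x n a (suc b)) (*-congˡ (+-cong (gbin-trinomial x n (suc a) b) (*-congˡ (gbin-trinomial x n (suc a) (suc b))))) ⟩
    N a (suc b) + pa * (N (suc a) b + pb * N (suc a) (suc b))
      ≈⟨ +-congˡ (*-congˡ (+-congʳ (*-cong (gbin-cong x {n = n} ≡.refl (≡.sym a+1+b)) (gbin-cong x (≡.sym a+1+b) ≡.refl)))) ⟩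
    G₁ * H₁ + pa * (G₁ * H₂ + pb * (G₂ * (H₁ + pa * H₂)))
      ≈⟨ solve 6 (λ G₁ G₂ H₁ H₂ pa pb → G₁ :* H₁ :+ pa :* (G₁ :* H₂ :+ pb :* (G₂ :* (H₁ :+ pa :* H₂)))
                := (G₁ :+ (pa :* pb) :* G₂) :* (H₁ :+ pa :* H₂)) refl G₁ G₂ H₁ H₂ pa pb ⟩
    (G₁ + (pa * pb) * G₂) * (H₁ + pa * H₂)
      ≈⟨ *-congʳ (+-congˡ (*-congʳ (sym (pow-+ x (suc a) (suc b))))) ⟩
    (G₁ + pow R x (suc a ℕ.+ suc b) * G₂) * (H₁ + pa * H₂) ∎
    where
    pa = pow R x (suc a)
    pb = pow R x (suc b)
    a+1+b = ℕP.+-suc a b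
    M N : ℕ → ℕ → Carrier
    M a b = gbin R x n a * gbin R x (n ∸ a) b
    N a b = gbin R x n (a ℕ.+ b) * gbin R x (a ℕ.+ b) a
    G₁ = gbin R x n (a ℕ.+ suc b)
    G₂ = gbin R x n (suc a ℕ.+ suc b)
    H₁ = gbin R x (a ℕ.+ suc b) a
    H₂ = gbin R x (a ℕ.+ suc b) (suc a)

  gbin-trinomial-swap : ∀ x n a b → gbin R x n a * gbin R x (n ∸ a) b ≈ gbin R x n b * gbin R x (n ∸ b) a
  gbin-trinomial-swap x n a b = begin
    gbin R x n a * gbin R x (n ∸ a) b             ≈⟨ gbin-trinomial x n a b ⟩
    gbin R x n (a ℕ.+ b) * gbin R x (a ℕ.+ b) a   ≈⟨ *-congˡ (gbin-sym x a b) ⟩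
    gbin R x n (a ℕ.+ b) * gbin R x (a ℕ.+ b) b   ≈⟨ *-cong (gbin-cong x {n = n} ≡.refl a+b≡b+a) (gbin-cong x a+b≡b+a ≡.refl) ⟩
    gbin R x n (b ℕ.+ a) * gbin R x (b ℕ.+ a) b   ≈⟨ sym (gbin-trinomial x n b a) ⟩
    gbin R x n b * gbin R x (n ∸ b) a             ∎
    where a+b≡b+a = ℕP.+-comm a b

  gbin-trinomial-vanish : ∀ x {n} a b → n < a ℕ.+ b → gbin R x n a * gbin R x (n ∸ a) b ≈ 0#
  gbin-trinomial-vanish x a b n<a+b = trans (gbin-trinomial x _ a b) (0*y≈0 (gbin-vanish x n<a+b))

  gbin-rearrange : ∀ x L m w r → let i = m ℕ.+ (m ℕ.+ w) ℕ.+ r ; N = r ℕ.+ m in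
    gbin R x L i * (gbin R x i m * gbin R x (i ∸ m) (m ℕ.+ w)) ≈ gbin R x L N * gbin R x N r * gbin R x (L ∸ N) (m ℕ.+ w)
  gbin-rearrange x L m w r = sym (begin
    B L N * B N r * B (L ∸ N) (m ℕ.+ w)         ≈⟨ solve 3 (λ a b c → a :* b :* c := (a :* c) :* b) refl _ _ _ ⟩
    (B L N * B (L ∸ N) (m ℕ.+ w)) * B N r       ≈⟨ *-congʳ (gbin-trinomial x L N (m ℕ.+ w)) ⟩
    (B L i′ * B i′ N) * B N r                   ≈⟨ *-assoc _ _ _ ⟩
    B L i′ * (B i′ N * B N r)                   ≈⟨ *-congˡ (sym (gbin-trinomial x i′ r m)) ⟩
    B L i′ * (B i′ r * B (i′ ∸ r) m)            ≡⟨ ≡.cong (λ k → B L k * (B k r * B (k ∸ r) m)) i′≡i ⟩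
    B L i * (B i r * B (i ∸ r) m)               ≈⟨ *-congˡ (gbin-trinomial-swap x i r m) ⟩
    B L i * (B i m * B (i ∸ m) r)               ≈⟨ *-congˡ (*-congˡ (trans (gbin-cong x i∸m ≡.refl)
                                                      (trans (sym (gbin-sym x (m ℕ.+ w) r)) (gbin-cong x (≡.sym i∸m) ≡.refl)))) ⟩
    B L i * (B i m * B (i ∸ m) (m ℕ.+ w))       ∎)
    where
    B = gbin R x
    i = m ℕ.+ (m ℕ.+ w) ℕ.+ r
    N = r ℕ.+ m
    i′ = N ℕ.+ (m ℕ.+ w)
    i′≡i : i′ ≡ i
    i′≡i = reorder r m w
      where
      reorder : ∀ r m w → r ℕ.+ m ℕ.+ (m ℕ.+ w) ≡ m ℕ.+ (m ℕ.+ w) ℕ.+ r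
      reorder = ℕ-Solver.solve-∀
    i∸m : i ∸ m ≡ (m ℕ.+ w) ℕ.+ r
    i∸m = ≡.trans (≡.cong (_∸ m) (ℕP.+-assoc m (m ℕ.+ w) r)) (ℕP.m+n∸m≡n m ((m ℕ.+ w) ℕ.+ r))

  gbin-vandermonde : ∀ x m n k →
    gbin R x (m ℕ.+ n) k ≈ sumN R (suc k) (λ j → gbin R x m j * gbin R x n (k ∸ j) * pow R x ((m ∸ j) ℕ.* (k ∸ j)))
  gbin-vandermonde x zero n k = sym (begin
    sumN R (suc k) f                              ≈⟨ sumN-sucˡ k f ⟩
    f 0 + sumN R k (λ j → f (suc j))              ≈⟨ +-cong (trans (*-identityʳ _) (*-identityˡ _)) (sumN-zero k (λ j _ → 0*y≈0 (zeroˡ _))) ⟩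
    gbin R x n k + 0#                             ≈⟨ +-identityʳ _ ⟩
    gbin R x n k                                  ∎)
    where f = λ j → gbin R x 0 j * gbin R x n (k ∸ j) * pow R x ((0 ∸ j) ℕ.* (k ∸ j))
  gbin-vandermonde x (suc m) n k = begin
    gbin R x (suc (m ℕ.+ n)) k                                           ≈⟨ gbin-pascal x (m ℕ.+ n) k ⟩
    prev (gbin R x (m ℕ.+ n)) k + pow R x k * gbin R x (m ℕ.+ n) k       ≈⟨ +-cong (lower k) (*-congˡ (gbin-vandermonde x m n k)) ⟩
    sumN R (suc k) (λ j → prev (gbin R x m) j * B j * P j) + pow R x k * sumN R (suc k) (λ j → gbin R x m j * B j * P′ j)
      ≈⟨ +-congˡ (trans (sumN-*ˡ (suc k) _ _) (sumN-cong (suc k) upper)) ⟩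
    sumN R (suc k) (λ j → prev (gbin R x m) j * B j * P j) + sumN R (suc k) (λ j → (pow R x j * gbin R x m j) * B j * P j)
      ≈⟨ sym (sumN-+ (suc k) _ _) ⟩
    sumN R (suc k) (λ j → prev (gbin R x m) j * B j * P j + (pow R x j * gbin R x m j) * B j * P j)
      ≈⟨ sumN-cong (suc k) (λ j _ → sym (trans (*-congʳ (*-congʳ (gbin-pascal x m j)))
           (solve 4 (λ a b c d → (a :+ b) :* c :* d := a :* c :* d :+ b :* c :* d) refl _ _ _ _))) ⟩
    sumN R (suc k) (λ j → gbin R x (suc m) j * B j * P j) ∎
    where
    B = λ j → gbin R x n (k ∸ j)
    P = λ j → pow R x ((suc m ∸ j) ℕ.* (k ∸ j))
    P′ = λ j → pow R x ((m ∸ j) ℕ.* (k ∸ j))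
    lower : ∀ k → prev (gbin R x (m ℕ.+ n)) k ≈ sumN R (suc k) (λ j → prev (gbin R x m) j * gbin R x n (k ∸ j) * pow R x ((suc m ∸ j) ℕ.* (k ∸ j)))
    lower zero    = sym (trans (+-identityˡ _) (0*y≈0 (zeroˡ _)))
    lower (suc k) = trans (gbin-vandermonde x m n k)
      (sym (trans (sumN-sucˡ (suc k) _) (trans (+-congʳ (0*y≈0 (zeroˡ _))) (+-identityˡ _))))
    upper : ∀ j → j < suc k → pow R x k * (gbin R x m j * B j * P′ j) ≈ (pow R x j * gbin R x m j) * B j * P j
    upper j (s≤s j≤k) with ℕP.≤-<-connex j m
    ... | inj₁ j≤m = begin
      pow R x k * (gbin R x m j * B j * P′ j)        ≈⟨ solve 4 (λ p g b e → p :* (g :* b :* e) := g :* b :* (p :* e)) refl _ _ _ _ ⟩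
      gbin R x m j * B j * (pow R x k * P′ j)        ≈⟨ *-congˡ (sym (pow-+ x k _)) ⟩
      gbin R x m j * B j * pow R x (k ℕ.+ (m ∸ j) ℕ.* (k ∸ j))
        ≡⟨ ≡.cong (λ e → gbin R x m j * B j * pow R x e) (≡.sym (j+[1+m∸j]*[k∸j]≡k+[m∸j]*[k∸j] j≤m j≤k)) ⟩
      gbin R x m j * B j * pow R x (j ℕ.+ (suc m ∸ j) ℕ.* (k ∸ j))   ≈⟨ *-congˡ (pow-+ x j _) ⟩
      gbin R x m j * B j * (pow R x j * P j)        ≈⟨ solve 4 (λ g b p e → g :* b :* (p :* e) := (p :* g) :* b :* e) refl _ _ _ _ ⟩
      (pow R x j * gbin R x m j) * B j * P j        ∎
    ... | inj₂ m<j = trans (x*0≈0 (0*y≈0 (0*y≈0 gm≈0))) (sym (0*y≈0 (0*y≈0 (x*0≈0 gm≈0))))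
      where gm≈0 = gbin-vanish x m<j

  gbin-vandermonde-offset : ∀ x m n w → w ≤ n →
    sumN R (suc m) (λ N → pow R x (N ℕ.* (N ℕ.+ w)) * gbin R x m N * gbin R x n (N ℕ.+ w)) ≈ gbin R x (m ℕ.+ n) (n ∸ w)
  gbin-vandermonde-offset x m n w w≤n with ℕP.m≤n⇒∃[o]m+o≡n w≤n
  ... | K , ≡.refl = sym (begin
    gbin R x (m ℕ.+ (w ℕ.+ K)) ((w ℕ.+ K) ∸ w)   ≈⟨ gbin-cong x (ℕP.+-comm m (w ℕ.+ K)) (ℕP.m+n∸m≡n w K) ⟩
    gbin R x ((w ℕ.+ K) ℕ.+ m) K                  ≈⟨ gbin-vandermonde x (w ℕ.+ K) m K ⟩
    sumN R (suc K) f                              ≈⟨ sumN-reverse K f ⟩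
    sumN R (suc K) (λ j → f (K ∸ j))              ≈⟨ sumN-cong (suc K) reversed ⟩
    sumN R (suc K) g                              ≈⟨ sumN-support (suc K) (suc m) g g≈0 g≈0′ ⟩
    sumN R (suc m) g                              ∎)
    where
    f = λ j → gbin R x (w ℕ.+ K) j * gbin R x m (K ∸ j) * pow R x (((w ℕ.+ K) ∸ j) ℕ.* (K ∸ j))
    g = λ N → pow R x (N ℕ.* (N ℕ.+ w)) * gbin R x m N * gbin R x (w ℕ.+ K) (N ℕ.+ w)
    reversed : ∀ N → N < suc K → f (K ∸ N) ≈ g N
    reversed N (s≤s N≤K) = begin
      gbin R x (w ℕ.+ K) (K ∸ N) * gbin R x m (K ∸ (K ∸ N)) * pow R x (((w ℕ.+ K) ∸ (K ∸ N)) ℕ.* (K ∸ (K ∸ N)))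
        ≈⟨ *-cong (*-cong complement (gbin-cong x {n = m} ≡.refl K∸[K∸N]≡N))
                  (≡⇒≈ (≡.cong₂ (λ u v → pow R x (u ℕ.* v)) ([w+k]∸[k∸n]≡n+w w N≤K) K∸[K∸N]≡N)) ⟩
      gbin R x (w ℕ.+ K) (N ℕ.+ w) * gbin R x m N * pow R x ((N ℕ.+ w) ℕ.* N)
        ≈⟨ solve 3 (λ a b p → a :* b :* p := p :* b :* a) refl _ _ _ ⟩
      pow R x ((N ℕ.+ w) ℕ.* N) * gbin R x m N * gbin R x (w ℕ.+ K) (N ℕ.+ w)
        ≡⟨ ≡.cong (λ e → pow R x e * gbin R x m N * gbin R x (w ℕ.+ K) (N ℕ.+ w)) (ℕP.*-comm (N ℕ.+ w) N) ⟩
      g N ∎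
      where
      K∸[K∸N]≡N = ℕP.m∸[m∸n]≡n N≤K
      total = [k∸n]+[n+w]≡w+k w N≤K
      complement : gbin R x (w ℕ.+ K) (K ∸ N) ≈ gbin R x (w ℕ.+ K) (N ℕ.+ w)
      complement = trans (gbin-cong x (≡.sym total) ≡.refl) (trans (gbin-sym x (K ∸ N) (N ℕ.+ w)) (gbin-cong x total ≡.refl))
    g≈0 : ∀ N → suc K ≤ N → g N ≈ 0#
    g≈0 N K<N = x*0≈0 (gbin-vanish x (≡.subst (_< N ℕ.+ w) (ℕP.+-comm K w) (ℕP.+-monoˡ-< w K<N)))
    g≈0′ : ∀ N → suc m ≤ N → g N ≈ 0#
    g≈0′ N m<N = 0*y≈0 (x*0≈0 (gbin-vanish x m<N))

  gbinZ-nonneg : ∀ x m {L w} → w ≤ L → gbinZ R x m (+ L ℤ.- + w) ≈ gbin R x m (L ∸ w)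
  gbinZ-nonneg x m w≤L = ≡⇒≈ (≡.cong (gbinZ R x m) (≡.sym (+[m∸n]≡+m-+n w≤L)))

  gbinZ-neg : ∀ x m {L w} → L < w → gbinZ R x m (+ L ℤ.- + w) ≈ 0#
  gbinZ-neg x m L<w = ≡⇒≈ (≡.cong (gbinZ R x m) (+m-+n≡-[1+n∸1+m] L<w))

  gbinZ-2L : ∀ x L a → ℤ.∣ a ∣ ≤ L → gbinZ R x (2 ℕ.* L) (+ L ℤ.- a) ≈ gbin R x (L ℕ.+ L) (L ∸ ℤ.∣ a ∣)
  gbinZ-2L x L (+ w)    w≤L   = trans (gbinZ-nonneg x _ w≤L) (gbin-cong x (2*n≡n+n L) ≡.refl)
  gbinZ-2L x L -[1+ u ] 1+u≤L = trans (gbin-cong x (2*n≡n+n L) ≡.refl) (sym (gbin-centre-sym x L 1+u≤L))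

  gbinZ-2L-vanish : ∀ x L a → L < ℤ.∣ a ∣ → gbinZ R x (2 ℕ.* L) (+ L ℤ.- a) ≈ 0#
  gbinZ-2L-vanish x L (+ w)    L<w   = gbinZ-neg x _ L<w
  gbinZ-2L-vanish x L -[1+ u ] L<1+u =
    gbin-vanish x (≡.subst (ℕ._< L ℕ.+ suc u) (≡.sym (2*n≡n+n L)) (ℕP.+-monoʳ-< L L<1+u))

  gbinZ-2L+1 : ∀ x L w → w ≤ L → gbinZ R x (suc (2 ℕ.* L)) (+ L ℤ.- + w) ≈ gbin R x (L ℕ.+ suc L) (L ∸ w)
  gbinZ-2L+1 x L w w≤L = trans (gbinZ-nonneg x _ w≤L) (gbin-cong x (1+2*n≡n+[1+n] L) ≡.refl)

  gbinZ-2L+1-neg : ∀ x L u → u ≤ L → gbinZ R x (suc (2 ℕ.* L)) (+ L ℤ.- -[1+ u ]) ≈ gbin R x (L ℕ.+ suc L) (L ∸ u)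
  gbinZ-2L+1-neg x L u u≤L = trans (gbin-cong x (1+2*n≡n+[1+n] L) (ℕP.+-suc L u)) (sym (gbin-centre-sym x (suc L) u≤L))

  module _ (s t : Carrier) (s*t≈1 : s * t ≈ 1#) where

    s^_ : ℤ → Carrier
    s^_ = spow R s t

    q q⁻¹ : Carrier
    q = qpow R s t (+ 1)
    q⁻¹ = qinvpow R s t (+ 1)

    s^-cong : ∀ {a b} → a ≡ b → s^ a ≈ s^ b
    s^-cong a≡b = ≡⇒≈ (≡.cong s^_ a≡b)

    s^-⊖ : ∀ m n → s^ (m ⊖ n) ≈ pow R s m * pow R t n
    s^-⊖ zero    zero    = sym (*-identityˡ 1#)
    s^-⊖ (suc m) zero    = sym (*-identityʳ _)
    s^-⊖ zero    (suc n) = sym (*-identityˡ _)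
    s^-⊖ (suc m) (suc n) = begin
      s^ (suc m ⊖ suc n)                        ≡⟨ ≡.cong s^_ (ℤP.[1+m]⊖[1+n]≡m⊖n m n) ⟩
      s^ (m ⊖ n)                                ≈⟨ s^-⊖ m n ⟩
      pow R s m * pow R t n                     ≈⟨ sym (trans (*-congʳ s*t≈1) (*-identityˡ _)) ⟩
      (s * t) * (pow R s m * pow R t n)         ≈⟨ solve 4 (λ s t a b → (s :* t) :* (a :* b) := (s :* a) :* (t :* b)) refl s t _ _ ⟩
      (s * pow R s m) * (t * pow R t n)         ∎

    s^-+ : ∀ a b → s^ (a ℤ.+ b) ≈ s^ a * s^ b
    s^-+ (+ m)    (+ n)    = pow-+ s m n
    s^-+ (+ m)    -[1+ n ] = s^-⊖ m (suc n)
    s^-+ -[1+ m ] (+ n)    = trans (s^-⊖ n (suc m)) (*-comm _ _)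
    s^-+ -[1+ m ] -[1+ n ] = begin
      pow R t (suc (suc (m ℕ.+ n)))     ≡⟨ ≡.cong (pow R t ∘ suc) (≡.sym (ℕP.+-suc m n)) ⟩
      pow R t (suc m ℕ.+ suc n)         ≈⟨ pow-+ t (suc m) (suc n) ⟩
      pow R t (suc m) * pow R t (suc n) ∎

    s^-neg : ∀ m → s^ (ℤ.- + m) ≈ pow R t m
    s^-neg zero    = refl
    s^-neg (suc m) = refl

    pow-q : ∀ n → pow R q n ≈ s^ (+ 2 ℤ.* + n)
    pow-q n = trans (sym (pow-* s 2 n)) (s^-cong (ℤP.pos-* 2 n))

    pow-q⁻¹ : ∀ n → pow R q⁻¹ n ≈ s^ (ℤ.- (+ 2 ℤ.* + n))
    pow-q⁻¹ n = trans (sym (pow-* t 2 n)) (trans (sym (s^-neg (2 ℕ.* n))) (s^-cong (≡.cong ℤ.-_ (ℤP.pos-* 2 n))))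

    gbin-q⁻¹ : ∀ n k → gbin R q⁻¹ n k ≈ s^ (ℤ.- (+ 2 ℤ.* (+ k ℤ.* (+ n ℤ.- + k)))) * gbin R q n k
    gbin-q⁻¹ n       zero    = trans (gbin-zero q⁻¹ n) (sym (trans (*-cong (s^-cong (no-exponent (+ n ℤ.- + 0))) (gbin-zero q n)) (*-identityˡ 1#)))
      where
      no-exponent : ∀ x → ℤ.- (+ 2 ℤ.* (+ 0 ℤ.* x)) ≡ + 0
      no-exponent = ℤ-Solver.solve-∀
    gbin-q⁻¹ zero    (suc k) = sym (zeroʳ _)
    gbin-q⁻¹ (suc n) (suc k) = begin
      gbin R q⁻¹ n k + pow R q⁻¹ (suc k) * gbin R q⁻¹ n (suc k)
        ≈⟨ +-cong (gbin-q⁻¹ n k) (*-cong (pow-q⁻¹ (suc k)) (gbin-q⁻¹ n (suc k))) ⟩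
      s^ e[n,k] * gbin R q n k + s^ (ℤ.- (+ 2 ℤ.* + suc k)) * (s^ e[n,1+k] * gbin R q n (suc k))
        ≈⟨ +-congˡ (trans (sym (*-assoc _ _ _)) (*-congʳ (trans (sym (s^-+ (ℤ.- (+ 2 ℤ.* + suc k)) e[n,1+k])) (s^-cong (pascal-exponent (+ n) (+ k)))))) ⟩
      s^ e[n,k] * gbin R q n k + s^ e[1+n,1+k] * gbin R q n (suc k)
        ≈⟨ +-congʳ lower-term ⟩
      s^ e[1+n,1+k] * (pow R q (n ∸ k) * gbin R q n k) + s^ e[1+n,1+k] * gbin R q n (suc k)
        ≈⟨ trans (sym (distribˡ _ _ _)) (*-congˡ (+-comm _ _)) ⟩
      s^ e[1+n,1+k] * (gbin R q n (suc k) + pow R q (n ∸ k) * gbin R q n k)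
        ≈⟨ *-congˡ (sym (gbin-pascal′ q n k)) ⟩
      s^ e[1+n,1+k] * gbin R q (suc n) (suc k) ∎
      where
      e : ℤ → ℤ → ℤ
      e n k = ℤ.- (+ 2 ℤ.* (k ℤ.* (n ℤ.- k)))
      e[n,k] = e (+ n) (+ k)
      e[n,1+k] = e (+ n) (+ suc k)
      e[1+n,1+k] = e (+ suc n) (+ suc k)
      pascal-exponent : ∀ n k → ℤ.- (+ 2 ℤ.* (+ 1 ℤ.+ k)) ℤ.+ ℤ.- (+ 2 ℤ.* ((+ 1 ℤ.+ k) ℤ.* (n ℤ.- (+ 1 ℤ.+ k))))
                                ≡ ℤ.- (+ 2 ℤ.* ((+ 1 ℤ.+ k) ℤ.* ((+ 1 ℤ.+ n) ℤ.- (+ 1 ℤ.+ k))))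
      pascal-exponent = ℤ-Solver.solve-∀
      shift-exponent : ∀ n k → ℤ.- (+ 2 ℤ.* ((+ 1 ℤ.+ k) ℤ.* ((+ 1 ℤ.+ n) ℤ.- (+ 1 ℤ.+ k)))) ℤ.+ + 2 ℤ.* (n ℤ.- k)
                               ≡ ℤ.- (+ 2 ℤ.* (k ℤ.* (n ℤ.- k)))
      shift-exponent = ℤ-Solver.solve-∀
      lower-term : s^ e[n,k] * gbin R q n k ≈ s^ e[1+n,1+k] * (pow R q (n ∸ k) * gbin R q n k)
      lower-term with ℕP.≤-<-connex k n
      ... | inj₁ k≤n = begin
        s^ e[n,k] * gbin R q n k                                          ≡⟨ ≡.cong (λ x → s^ x * gbin R q n k) (≡.sym (≡.trans
                                                                               (≡.cong (λ d → e[1+n,1+k] ℤ.+ + 2 ℤ.* d) (+[m∸n]≡+m-+n k≤n)) (shift-exponent (+ n) (+ k)))) ⟩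
        s^ (e[1+n,1+k] ℤ.+ + 2 ℤ.* + (n ∸ k)) * gbin R q n k              ≈⟨ *-congʳ (trans (s^-+ e[1+n,1+k] (+ 2 ℤ.* + (n ∸ k))) (*-congˡ (sym (pow-q (n ∸ k))))) ⟩
        (s^ e[1+n,1+k] * pow R q (n ∸ k)) * gbin R q n k                  ≈⟨ *-assoc _ _ _ ⟩
        s^ e[1+n,1+k] * (pow R q (n ∸ k) * gbin R q n k)                  ∎
      ... | inj₂ n<k = trans (x*0≈0 (gbin-vanish q n<k)) (sym (x*0≈0 (x*0≈0 (gbin-vanish q n<k))))

    T-base-q : ∀ c L a → T R s t c L a ≈
      sumN R (suc L) (λ n → s^ (weight c (+ L ℤ.- + n ℤ.- + n ℤ.- a)) * (gbin R q L n * gbinZ R q (L ∸ n) (+ n ℤ.+ a)))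
    T-base-q c L a = trans (sumN-*ˡ (suc L) _ _) (sumN-cong (suc L) term)
      where
      pre = + L ℤ.* (+ L ℤ.- c) ℤ.- a ℤ.* (a ℤ.- c)
      term : ∀ n → n < suc L →
        s^ pre * (s^ (ℤ.- (+ 2 ℤ.* (+ n ℤ.* (+ n ℤ.+ (a ℤ.- c))))) * (gbin R q⁻¹ L n * gbinZ R q⁻¹ (L ∸ n) (+ n ℤ.+ a)))
          ≈ s^ (weight c (+ L ℤ.- + n ℤ.- + n ℤ.- a)) * (gbin R q L n * gbinZ R q (L ∸ n) (+ n ℤ.+ a))
      term n (s≤s n≤L) with + n ℤ.+ a in n+a≡k
      ... | -[1+ k ] = trans (x*0≈0 (x*0≈0 (zeroʳ _))) (sym (x*0≈0 (zeroʳ _)))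
      ... | + k = begin
        s^ pre * (s^ e₁ * (gbin R q⁻¹ L n * gbin R q⁻¹ (L ∸ n) k))
          ≈⟨ *-congˡ (*-congˡ (*-cong (gbin-q⁻¹ L n) (gbin-q⁻¹ (L ∸ n) k))) ⟩
        s^ pre * (s^ e₁ * ((s^ e₂ * gbin R q L n) * (s^ e₃ * gbin R q (L ∸ n) k)))
          ≈⟨ solve 6 (λ a b c d x y → a :* (b :* ((c :* x) :* (d :* y))) := (((a :* b) :* c) :* d) :* (x :* y)) refl _ _ _ _ _ _ ⟩
        (((s^ pre * s^ e₁) * s^ e₂) * s^ e₃) * (gbin R q L n * gbin R q (L ∸ n) k)
          ≈⟨ *-congʳ (sym (trans (s^-+ (pre ℤ.+ e₁ ℤ.+ e₂) e₃) (*-congʳ (trans (s^-+ (pre ℤ.+ e₁) e₂) (*-congʳ (s^-+ pre e₁)))))) ⟩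
        s^ (pre ℤ.+ e₁ ℤ.+ e₂ ℤ.+ e₃) * (gbin R q L n * gbin R q (L ∸ n) k)
          ≈⟨ *-congʳ (s^-cong (≡.trans (≡.cong₂ (λ k l → pre ℤ.+ e₁ ℤ.+ e₂ ℤ.+ ℤ.- (+ 2 ℤ.* (k ℤ.* (l ℤ.- k))))
                                          (≡.sym n+a≡k) (+[m∸n]≡+m-+n n≤L))
                                        (exponent (+ L) (+ n) a c))) ⟩
        s^ (weight c (+ L ℤ.- + n ℤ.- + n ℤ.- a)) * (gbin R q L n * gbin R q (L ∸ n) k) ∎
        where
        e₁ = ℤ.- (+ 2 ℤ.* (+ n ℤ.* (+ n ℤ.+ (a ℤ.- c))))
        e₂ = ℤ.- (+ 2 ℤ.* (+ n ℤ.* (+ L ℤ.- + n)))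
        e₃ = ℤ.- (+ 2 ℤ.* (+ k ℤ.* (+ (L ∸ n) ℤ.- + k)))
        exponent : ∀ L n a c →
          (L ℤ.* (L ℤ.- c) ℤ.- a ℤ.* (a ℤ.- c)) ℤ.+ ℤ.- (+ 2 ℤ.* (n ℤ.* (n ℤ.+ (a ℤ.- c))))
            ℤ.+ ℤ.- (+ 2 ℤ.* (n ℤ.* (L ℤ.- n))) ℤ.+ ℤ.- (+ 2 ℤ.* ((n ℤ.+ a) ℤ.* ((L ℤ.- n) ℤ.- (n ℤ.+ a))))
          ≡ (L ℤ.- n ℤ.- n ℤ.- a) ℤ.* ((L ℤ.- n ℤ.- n ℤ.- a) ℤ.- c)
        exponent = ℤ-Solver.solve-∀

    -- T_c(L; w) = T_c(L; -w), written in base q.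
    Tq : ℤ → ℕ → ℕ → Carrier
    Tq c L w = sumN R (suc L) (λ m → s^ (weight c (+ L ℤ.- + m ℤ.- + m ℤ.- + w)) * (gbin R q L m * gbin R q (L ∸ m) (m ℕ.+ w)))

    T-neg : ∀ c L u → T R s t c L -[1+ u ] ≈ Tq c L (suc u)
    T-neg c L u = trans (T-base-q c L -[1+ u ]) (trans (sumN-translate (suc L) (suc u) f f≈0ˡ f≈0ʳ) (sumN-cong (suc L) term))
      where
      f = λ n → s^ (weight c (+ L ℤ.- + n ℤ.- + n ℤ.- -[1+ u ])) * (gbin R q L n * gbinZ R q (L ∸ n) (+ n ℤ.+ -[1+ u ]))
      f≈0ˡ : ∀ n → n < suc u → f n ≈ 0#
      f≈0ˡ n (s≤s n≤u) = x*0≈0 (x*0≈0 (≡⇒≈ (≡.cong (gbinZ R q (L ∸ n)) (+n+-[1+u]≡-[1+u∸n] n≤u))))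
      f≈0ʳ : ∀ n → suc L ≤ n → f n ≈ 0#
      f≈0ʳ n L<n = x*0≈0 (0*y≈0 (gbin-vanish q L<n))
      term : ∀ m → m < suc L → f (suc u ℕ.+ m) ≈ s^ (weight c (+ L ℤ.- + m ℤ.- + m ℤ.- + suc u)) * (gbin R q L m * gbin R q (L ∸ m) (m ℕ.+ suc u))
      term m _ = *-cong (s^-cong (≡.cong (weight c) (same-base (+ L) (+ suc u) (+ m))))
        (trans (*-congˡ (≡⇒≈ (≡.cong (gbinZ R q (L ∸ (suc u ℕ.+ m))) (+[1+u+m]+-[1+u]≡+m u m))))
          (trans (gbin-trinomial-swap q L (suc u ℕ.+ m) m) (*-congˡ (gbin-cong q {n = L ∸ m} ≡.refl (ℕP.+-comm (suc u) m)))))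
        where
        same-base : ∀ L w m → L ℤ.- (w ℤ.+ m) ℤ.- (w ℤ.+ m) ℤ.- (ℤ.- w) ≡ L ℤ.- m ℤ.- m ℤ.- w
        same-base = ℤ-Solver.solve-∀

    Tq-vanish : ∀ c {i w} → i < w → Tq c i w ≈ 0#
    Tq-vanish c {i} {w} i<w = sumN-zero (suc i) (λ m _ → x*0≈0 (x*0≈0 (gbin-vanish q (small m))))
      where
      small : ∀ m → i ∸ m < m ℕ.+ w
      small m = ℕP.≤-<-trans (ℕP.m∸n≤m i m) (ℕP.<-≤-trans i<w (ℕP.m≤n+m w m))

    transform : ℤ → ℕ → (ℕ → Carrier) → Carrier
    transform c L F = sumN R (suc L) (λ i → s^ (weight c (+ i)) * gbin R q L i * F i)

    gbin-pair-sum : ℤ → ℕ → ℕ → Carrier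
    gbin-pair-sum c L w = sumN R (suc L) (λ N → gbin R q L N * gbin R q L (N ℕ.+ w) * s^ (weight c (+ N) ℤ.+ weight c (+ (N ℕ.+ w))))

    private
      summand : ℤ → ℕ → ℕ → ℕ → ℕ → Carrier
      summand c L w i m = (s^ (weight c (+ i)) * gbin R q L i)
                        * (s^ (weight c (+ i ℤ.- + m ℤ.- + m ℤ.- + w)) * (gbin R q i m * gbin R q (i ∸ m) (m ℕ.+ w)))

      summand′ : ℤ → ℕ → ℕ → ℕ → ℕ → Carrier
      summand′ c L w N j = (gbin R q L N * s^ (weight c (+ N) ℤ.+ weight c (+ (N ℕ.+ w))))
                         * (gbin R q N j * gbin R q (L ∸ N) ((N ℕ.+ w) ∸ j) * pow R q ((N ∸ j) ℕ.* ((N ℕ.+ w) ∸ j)))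

      -- i = 2m + w + r and N = m + r: both sides are q-trinomials times the same power of s.
      summand-reindex : ∀ c L w m r → summand c L w (m ℕ.+ (m ℕ.+ w) ℕ.+ r) m ≈ summand′ c L w (r ℕ.+ m) r
      summand-reindex c L w m r = sym (begin
        (B L N * s^ e₁) * (B N r * B (L ∸ N) ((N ℕ.+ w) ∸ r) * pow R q ((N ∸ r) ℕ.* ((N ℕ.+ w) ∸ r)))
          ≡⟨ ≡.cong₂ (λ k l → (B L N * s^ e₁) * (B N r * B (L ∸ N) l * pow R q (k ℕ.* l))) N∸r N+w∸r ⟩
        (B L N * s^ e₁) * (B N r * B (L ∸ N) (m ℕ.+ w) * pow R q (m ℕ.* (m ℕ.+ w)))
          ≈⟨ *-congˡ (*-congˡ (trans (pow-q (m ℕ.* (m ℕ.+ w))) (s^-cong (≡.cong (+ 2 ℤ.*_) (ℤP.pos-* m (m ℕ.+ w)))))) ⟩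
        (B L N * s^ e₁) * (B N r * B (L ∸ N) (m ℕ.+ w) * s^ e₂)
          ≈⟨ solve 5 (λ a e b d g → (a :* e) :* (b :* d :* g) := (e :* g) :* (a :* b :* d)) refl _ _ _ _ _ ⟩
        (s^ e₁ * s^ e₂) * (B L N * B N r * B (L ∸ N) (m ℕ.+ w))
          ≈⟨ *-cong (sym (s^-+ e₁ e₂)) (sym (gbin-rearrange q L m w r)) ⟩
        s^ (e₁ ℤ.+ e₂) * (B L i * (B i m * B (i ∸ m) (m ℕ.+ w)))
          ≈⟨ *-congʳ (trans (s^-cong (≡.sym (exponent c (+ m) (+ w) (+ r)))) (s^-+ (weight c (+ i)) _)) ⟩
        (s^ (weight c (+ i)) * s^ (weight c (+ i ℤ.- + m ℤ.- + m ℤ.- + w))) * (B L i * (B i m * B (i ∸ m) (m ℕ.+ w)))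
          ≈⟨ solve 4 (λ a b d e → (a :* b) :* (d :* e) := (a :* d) :* (b :* e)) refl _ _ _ _ ⟩
        summand c L w i m ∎)
        where
        B = gbin R q
        i = m ℕ.+ (m ℕ.+ w) ℕ.+ r
        N = r ℕ.+ m
        e₁ = weight c (+ N) ℤ.+ weight c (+ (N ℕ.+ w))
        e₂ = + 2 ℤ.* (+ m ℤ.* (+ m ℤ.+ + w))
        N∸r : N ∸ r ≡ m
        N∸r = ℕP.m+n∸m≡n r m
        N+w∸r : (N ℕ.+ w) ∸ r ≡ m ℕ.+ w
        N+w∸r = ≡.trans (≡.cong (_∸ r) (ℕP.+-assoc r m w)) (ℕP.m+n∸m≡n r (m ℕ.+ w))
        exponent : ∀ c m w r → let i = m ℤ.+ (m ℤ.+ w) ℤ.+ r in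
          i ℤ.* (i ℤ.- c) ℤ.+ (i ℤ.- m ℤ.- m ℤ.- w) ℤ.* ((i ℤ.- m ℤ.- m ℤ.- w) ℤ.- c)
            ≡ ((r ℤ.+ m) ℤ.* ((r ℤ.+ m) ℤ.- c) ℤ.+ ((r ℤ.+ m) ℤ.+ w) ℤ.* (((r ℤ.+ m) ℤ.+ w) ℤ.- c)) ℤ.+ + 2 ℤ.* (m ℤ.* (m ℤ.+ w))
        exponent = ℤ-Solver.solve-∀

    -- Expand T_c(i; w) as a sum over m, exchange the order of summation, and
    -- resum over i with the q-Vandermonde identity.
    transform-Tq : ∀ c L w → transform c L (λ i → Tq c i w) ≈ gbin-pair-sum c L w
    transform-Tq c L w = begin
      transform c L (λ i → Tq c i w)                                  ≈⟨ sumN-cong (suc L) expand ⟩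
      sumN R (suc L) (λ i → sumN R (suc L) (summand c L w i))        ≈⟨ sumN-swap (suc L) (suc L) _ ⟩
      sumN R (suc L) (λ m → sumN R (suc L) (λ i → summand c L w i m))
        ≈⟨ sumN-cong (suc L) (λ m _ → sumN-translate (suc L) (m ℕ.+ (m ℕ.+ w)) _ (low m) high) ⟩
      sumN R (suc L) (λ m → sumN R (suc L) (λ r → summand c L w (m ℕ.+ (m ℕ.+ w) ℕ.+ r) m))
        ≈⟨ sumN-cong (suc L) (λ m _ → sumN-cong (suc L) (λ r _ → summand-reindex c L w m r)) ⟩
      sumN R (suc L) (λ m → sumN R (suc L) (λ r → summand′ c L w (r ℕ.+ m) r))
        ≈⟨ sumN-swap (suc L) (suc L) _ ⟩
      sumN R (suc L) (λ r → sumN R (suc L) (λ m → summand′ c L w (r ℕ.+ m) r))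
        ≈⟨ sumN-cong (suc L) (λ j _ → sym (sumN-translate (suc L) j _ (low′ j) (high′ j))) ⟩
      sumN R (suc L) (λ j → sumN R (suc L) (λ N → summand′ c L w N j)) ≈⟨ sym (sumN-swap (suc L) (suc L) _) ⟩
      sumN R (suc L) (λ N → sumN R (suc L) (summand′ c L w N))       ≈⟨ sym (sumN-cong (suc L) contract) ⟩
      gbin-pair-sum c L w                                             ∎
      where
      expand : ∀ i → i < suc L → s^ (weight c (+ i)) * gbin R q L i * Tq c i w ≈ sumN R (suc L) (summand c L w i)
      expand i (s≤s i≤L) = trans (*-congˡ (sym (sumN-extend _ (s≤s i≤L) (λ m i<m → x*0≈0 (0*y≈0 (gbin-vanish q i<m))))))
                                 (sumN-*ˡ (suc L) _ _)
      low : ∀ m i → i < m ℕ.+ (m ℕ.+ w) → summand c L w i m ≈ 0#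
      low m i i<2m+w = x*0≈0 (x*0≈0 (gbin-trinomial-vanish q m (m ℕ.+ w) i<2m+w))
      high : ∀ {m} i → suc L ≤ i → summand c L w i m ≈ 0#
      high i L<i = 0*y≈0 (x*0≈0 (gbin-vanish q L<i))
      low′ : ∀ j N → N < j → summand′ c L w N j ≈ 0#
      low′ j N N<j = x*0≈0 (0*y≈0 (0*y≈0 (gbin-vanish q N<j)))
      high′ : ∀ j N → suc L ≤ N → summand′ c L w N j ≈ 0#
      high′ j N L<N = 0*y≈0 (0*y≈0 (gbin-vanish q L<N))
      contract : ∀ N → N < suc L → gbin R q L N * gbin R q L (N ℕ.+ w) * s^ (weight c (+ N) ℤ.+ weight c (+ (N ℕ.+ w)))
                                   ≈ sumN R (suc L) (summand′ c L w N)
      contract N (s≤s N≤L) = begin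
        gbin R q L N * gbin R q L (N ℕ.+ w) * s^ e            ≈⟨ solve 3 (λ a b x → a :* b :* x := (a :* x) :* b) refl _ _ _ ⟩
        (gbin R q L N * s^ e) * gbin R q L (N ℕ.+ w)          ≈⟨ *-congˡ (trans (gbin-cong q (≡.sym (ℕP.m+[n∸m]≡n N≤L)) ≡.refl)
                                                                                (gbin-vandermonde q N (L ∸ N) (N ℕ.+ w))) ⟩
        (gbin R q L N * s^ e) * sumN R (suc (N ℕ.+ w)) V      ≈⟨ *-congˡ (sumN-support _ _ V (V≈0 (s≤s (ℕP.m≤m+n N w))) (V≈0 (s≤s N≤L))) ⟩
        (gbin R q L N * s^ e) * sumN R (suc L) V              ≈⟨ sumN-*ˡ (suc L) _ V ⟩
        sumN R (suc L) (summand′ c L w N)                     ∎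
        where
        e = weight c (+ N) ℤ.+ weight c (+ (N ℕ.+ w))
        V = λ j → gbin R q N j * gbin R q (L ∸ N) ((N ℕ.+ w) ∸ j) * pow R q ((N ∸ j) ℕ.* ((N ℕ.+ w) ∸ j))
        V≈0 : ∀ {M} → suc N ≤ M → ∀ j → M ≤ j → V j ≈ 0#
        V≈0 N<M j M≤j = 0*y≈0 (0*y≈0 (gbin-vanish q (ℕP.<-≤-trans N<M M≤j)))

    s^-+-pow-q : ∀ a x y → s^ (a ℤ.+ + 2 ℤ.* (+ x ℤ.* + y)) ≈ s^ a * pow R q (x ℕ.* y)
    s^-+-pow-q a x y = trans (s^-+ a _) (*-congˡ (sym (trans (pow-q (x ℕ.* y)) (s^-cong (≡.cong (+ 2 ℤ.*_) (ℤP.pos-* x y))))))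

    gbin-pair-sum-vanish : ∀ c {L w} → L < w → gbin-pair-sum c L w ≈ 0#
    gbin-pair-sum-vanish c {L} {w} L<w =
      sumN-zero (suc L) (λ N _ → 0*y≈0 (x*0≈0 (gbin-vanish q (ℕP.<-≤-trans L<w (ℕP.m≤n+m w N)))))

    gbin-pair-sum-0 : ∀ {L w} → w ≤ L → gbin-pair-sum (+ 0) L w ≈ s^ (weight (+ 0) (+ w)) * gbin R q (L ℕ.+ L) (L ∸ w)
    gbin-pair-sum-0 {L} {w} w≤L = begin
      gbin-pair-sum (+ 0) L w                                                              ≈⟨ sumN-cong (suc L) term ⟩
      sumN R (suc L) (λ N → s^ (weight (+ 0) (+ w)) * (pow R q (N ℕ.* (N ℕ.+ w)) * gbin R q L N * gbin R q L (N ℕ.+ w)))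
                                                                                           ≈⟨ sym (sumN-*ˡ (suc L) _ _) ⟩
      s^ (weight (+ 0) (+ w)) * sumN R (suc L) (λ N → pow R q (N ℕ.* (N ℕ.+ w)) * gbin R q L N * gbin R q L (N ℕ.+ w))
                                                                                           ≈⟨ *-congˡ (gbin-vandermonde-offset q L L w w≤L) ⟩
      s^ (weight (+ 0) (+ w)) * gbin R q (L ℕ.+ L) (L ∸ w)                                  ∎
      where
      exponent : ∀ N w → N ℤ.* (N ℤ.- + 0) ℤ.+ (N ℤ.+ w) ℤ.* ((N ℤ.+ w) ℤ.- + 0) ≡ w ℤ.* (w ℤ.- + 0) ℤ.+ + 2 ℤ.* (N ℤ.* (N ℤ.+ w))
      exponent = ℤ-Solver.solve-∀
      term : ∀ N → N < suc L → gbin R q L N * gbin R q L (N ℕ.+ w) * s^ (weight (+ 0) (+ N) ℤ.+ weight (+ 0) (+ (N ℕ.+ w)))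
                              ≈ s^ (weight (+ 0) (+ w)) * (pow R q (N ℕ.* (N ℕ.+ w)) * gbin R q L N * gbin R q L (N ℕ.+ w))
      term N _ = trans (*-congˡ (trans (s^-cong (exponent (+ N) (+ w))) (s^-+-pow-q (weight (+ 0) (+ w)) N (N ℕ.+ w))))
                       (solve 4 (λ a b x y → a :* b :* (x :* y) := x :* (y :* a :* b)) refl _ _ _ _)

    gbin-pair-sum-−1 : ∀ {L w} → w ≤ L →
      gbin-pair-sum (ℤ.- + 1) L w + gbin-pair-sum (ℤ.- + 1) L (suc w) ≈ s^ (weight (ℤ.- + 1) (+ w)) * gbin R q (L ℕ.+ suc L) (L ∸ w)
    gbin-pair-sum-−1 {L} {w} w≤L = begin
      gbin-pair-sum (ℤ.- + 1) L w + gbin-pair-sum (ℤ.- + 1) L (suc w)                       ≈⟨ sym (sumN-+ (suc L) _ _) ⟩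
      sumN R (suc L) (λ N → term₁ N + term₂ N)                                              ≈⟨ sumN-cong (suc L) term ⟩
      sumN R (suc L) (λ N → s^ w′ * (pow R q (N ℕ.* (N ℕ.+ suc w)) * gbin R q L N * gbin R q (suc L) (N ℕ.+ suc w)))
                                                                                            ≈⟨ sym (sumN-*ˡ (suc L) _ _) ⟩
      s^ w′ * sumN R (suc L) (λ N → pow R q (N ℕ.* (N ℕ.+ suc w)) * gbin R q L N * gbin R q (suc L) (N ℕ.+ suc w))
                                                                                            ≈⟨ *-congˡ (gbin-vandermonde-offset q L (suc L) (suc w) (s≤s w≤L)) ⟩
      s^ w′ * gbin R q (L ℕ.+ suc L) (L ∸ w)                                                ∎
      where
      w′ = weight (ℤ.- + 1) (+ w)
      term₁ term₂ : ℕ → Carrier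
      term₁ N = gbin R q L N * gbin R q L (N ℕ.+ w) * s^ (weight (ℤ.- + 1) (+ N) ℤ.+ weight (ℤ.- + 1) (+ (N ℕ.+ w)))
      term₂ N = gbin R q L N * gbin R q L (N ℕ.+ suc w) * s^ (weight (ℤ.- + 1) (+ N) ℤ.+ weight (ℤ.- + 1) (+ (N ℕ.+ suc w)))
      exponent₁ : ∀ N w → N ℤ.* (N ℤ.+ + 1) ℤ.+ (N ℤ.+ w) ℤ.* ((N ℤ.+ w) ℤ.+ + 1)
                          ≡ w ℤ.* (w ℤ.+ + 1) ℤ.+ + 2 ℤ.* (N ℤ.* (N ℤ.+ (+ 1 ℤ.+ w)))
      exponent₁ = ℤ-Solver.solve-∀
      exponent₂ : ∀ N w → N ℤ.* (N ℤ.+ + 1) ℤ.+ (N ℤ.+ (+ 1 ℤ.+ w)) ℤ.* ((N ℤ.+ (+ 1 ℤ.+ w)) ℤ.+ + 1)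
                          ≡ (w ℤ.* (w ℤ.+ + 1) ℤ.+ + 2 ℤ.* (N ℤ.* (N ℤ.+ (+ 1 ℤ.+ w)))) ℤ.+ + 2 ℤ.* (+ 1 ℤ.* (+ 1 ℤ.+ (N ℤ.+ w)))
      exponent₂ = ℤ-Solver.solve-∀
      term : ∀ N → N < suc L → term₁ N + term₂ N ≈ s^ w′ * (pow R q (N ℕ.* (N ℕ.+ suc w)) * gbin R q L N * gbin R q (suc L) (N ℕ.+ suc w))
      term N _ = begin
        term₁ N + term₂ N
          ≈⟨ +-cong (*-congˡ (trans (s^-cong (exponent₁ (+ N) (+ w))) (s^-+-pow-q w′ N (N ℕ.+ suc w))))
                    (*-congˡ (trans (s^-cong (exponent₂ (+ N) (+ w))) (trans (s^-+-pow-q (w′ ℤ.+ + 2 ℤ.* (+ N ℤ.* + (N ℕ.+ suc w))) 1 (suc (N ℕ.+ w)))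
                                                                            (*-cong (s^-+-pow-q w′ N (N ℕ.+ suc w)) (≡⇒≈ (≡.cong (pow R q) (ℕP.+-identityʳ (suc (N ℕ.+ w))))))))) ⟩
        a * b * (s^ w′ * x) + a * d * ((s^ w′ * x) * y)
          ≈⟨ solve 6 (λ a b d e x y → a :* b :* (e :* x) :+ a :* d :* ((e :* x) :* y) := e :* (x :* a :* (b :+ y :* d))) refl a b d (s^ w′) x y ⟩
        s^ w′ * (x * a * (b + y * d))
          ≈⟨ *-congˡ (*-congˡ (sym (trans (gbin-cong q {n = suc L} ≡.refl (ℕP.+-suc N w))
                                           (+-congˡ (*-congˡ (gbin-cong q {n = L} ≡.refl (≡.sym (ℕP.+-suc N w)))))))) ⟩
        s^ w′ * (x * a * gbin R q (suc L) (N ℕ.+ suc w)) ∎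
        where
        a = gbin R q L N
        b = gbin R q L (N ℕ.+ w)
        d = gbin R q L (N ℕ.+ suc w)
        x = pow R q (N ℕ.* (N ℕ.+ suc w))
        y = pow R q (suc (N ℕ.+ w))

    private
      pair-exponent₁ : ℕ → ℕ → ℤ
      pair-exponent₁ w N = weight (+ 1) (+ N) ℤ.+ weight (+ 1) (+ (N ℕ.+ w))

      pair-sum-1-upper : ∀ L′ w → w ≤ suc L′ →
        sumN R (suc (suc L′)) (λ N → (pow R q N * gbin R q L′ N) * gbin R q (suc L′) (N ℕ.+ w) * s^ (pair-exponent₁ w N))
          ≈ s^ (weight (+ 1) (+ w)) * gbin R q (L′ ℕ.+ suc L′) (suc L′ ∸ w)
      pair-sum-1-upper L′ w w≤L = begin
        sumN R (suc L) (λ N → (pow R q N * gbin R q L′ N) * gbin R q L (N ℕ.+ w) * s^ (pair-exponent₁ w N))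
                                                            ≈⟨ sumN-cong (suc L) term ⟩
        sumN R (suc L) (λ N → E * g N)                      ≈⟨ sym (sumN-*ˡ (suc L) E g) ⟩
        E * sumN R (suc L) g                                ≈⟨ *-congˡ (sumN-extend g (ℕP.n≤1+n _) (λ N L′<N → 0*y≈0 (x*0≈0 (gbin-vanish q L′<N)))) ⟩
        E * sumN R (suc L′) g                               ≈⟨ *-congˡ (gbin-vandermonde-offset q L′ L w w≤L) ⟩
        E * gbin R q (L′ ℕ.+ L) (L ∸ w)                     ∎
        where
        L = suc L′
        E = s^ (weight (+ 1) (+ w))
        g = λ N → pow R q (N ℕ.* (N ℕ.+ w)) * gbin R q L′ N * gbin R q L (N ℕ.+ w)
        exponent : ∀ N w → + 2 ℤ.* N ℤ.+ (N ℤ.* (N ℤ.- + 1) ℤ.+ (N ℤ.+ w) ℤ.* ((N ℤ.+ w) ℤ.- + 1))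
                           ≡ w ℤ.* (w ℤ.- + 1) ℤ.+ + 2 ℤ.* (N ℤ.* (N ℤ.+ w))
        exponent = ℤ-Solver.solve-∀
        term : ∀ N → N < suc L → (pow R q N * gbin R q L′ N) * gbin R q L (N ℕ.+ w) * s^ (pair-exponent₁ w N) ≈ E * g N
        term N _ = begin
          (pow R q N * gbin R q L′ N) * gbin R q L (N ℕ.+ w) * s^ (pair-exponent₁ w N)
            ≈⟨ solve 4 (λ p a b x → (p :* a) :* b :* x := (p :* x) :* a :* b) refl _ _ _ _ ⟩
          (pow R q N * s^ (pair-exponent₁ w N)) * gbin R q L′ N * gbin R q L (N ℕ.+ w)
            ≈⟨ *-congʳ (*-congʳ (begin
                 pow R q N * s^ (pair-exponent₁ w N)                             ≈⟨ *-congʳ (pow-q N) ⟩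
                 s^ (+ 2 ℤ.* + N) * s^ (pair-exponent₁ w N)                      ≈⟨ sym (s^-+ (+ 2 ℤ.* + N) (pair-exponent₁ w N)) ⟩
                 s^ (+ 2 ℤ.* + N ℤ.+ pair-exponent₁ w N)                         ≡⟨ ≡.cong s^_ (exponent (+ N) (+ w)) ⟩
                 s^ (weight (+ 1) (+ w) ℤ.+ + 2 ℤ.* (+ N ℤ.* + (N ℕ.+ w)))  ≈⟨ s^-+-pow-q (weight (+ 1) (+ w)) N (N ℕ.+ w) ⟩
                 E * pow R q (N ℕ.* (N ℕ.+ w))                       ∎)) ⟩
          (E * pow R q (N ℕ.* (N ℕ.+ w))) * gbin R q L′ N * gbin R q L (N ℕ.+ w)
            ≈⟨ solve 4 (λ e p a b → (e :* p) :* a :* b := e :* (p :* a :* b)) refl _ _ _ _ ⟩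
          E * g N ∎

      pair-sum-1-lower : ∀ L′ w → w ≤ suc L′ →
        sumN R (suc (suc L′)) (λ N → prev (gbin R q L′) N * gbin R q (suc L′) (N ℕ.+ w) * s^ (pair-exponent₁ w N))
          ≈ (s^ (weight (+ 1) (+ w)) * pow R q w) * prev (gbin R q (L′ ℕ.+ suc L′)) (suc L′ ∸ w)
      pair-sum-1-lower L′ w w≤L = begin
        sumN R (suc L) f                                    ≈⟨ sumN-sucˡ L f ⟩
        f 0 + sumN R L (λ N → f (suc N))                    ≈⟨ +-cong (0*y≈0 (0*y≈0 refl)) (sumN-cong L term) ⟩
        0# + sumN R L (λ N → E′ * h N)                      ≈⟨ trans (+-identityˡ _) (sym (sumN-*ˡ L E′ h)) ⟩
        E′ * sumN R (suc L′) h                              ≈⟨ *-congˡ evaluate ⟩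
        E′ * prev (gbin R q (L′ ℕ.+ L)) (L ∸ w)             ∎
        where
        L = suc L′
        E′ = s^ (weight (+ 1) (+ w)) * pow R q w
        f = λ N → prev (gbin R q L′) N * gbin R q L (N ℕ.+ w) * s^ (pair-exponent₁ w N)
        h = λ N → pow R q (N ℕ.* (N ℕ.+ suc w)) * gbin R q L′ N * gbin R q L (N ℕ.+ suc w)
        exponent : ∀ N w → (+ 1 ℤ.+ N) ℤ.* ((+ 1 ℤ.+ N) ℤ.- + 1) ℤ.+ ((+ 1 ℤ.+ N) ℤ.+ w) ℤ.* (((+ 1 ℤ.+ N) ℤ.+ w) ℤ.- + 1)
                           ≡ (w ℤ.* (w ℤ.- + 1) ℤ.+ + 2 ℤ.* (+ 1 ℤ.* w)) ℤ.+ + 2 ℤ.* (N ℤ.* (N ℤ.+ (+ 1 ℤ.+ w)))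
        exponent = ℤ-Solver.solve-∀
        term : ∀ N → N < L → f (suc N) ≈ E′ * h N
        term N _ = begin
          gbin R q L′ N * gbin R q L (suc N ℕ.+ w) * s^ (pair-exponent₁ w (suc N))
            ≈⟨ *-cong (*-congˡ (gbin-cong q {n = L} ≡.refl (≡.sym (ℕP.+-suc N w))))
                      (trans (s^-cong (exponent (+ N) (+ w)))
                             (trans (s^-+-pow-q (weight (+ 1) (+ w) ℤ.+ + 2 ℤ.* (+ 1 ℤ.* + w)) N (N ℕ.+ suc w)) (*-congʳ (trans (s^-+-pow-q (weight (+ 1) (+ w)) 1 w) (*-congˡ (≡⇒≈ (≡.cong (pow R q) (ℕP.+-identityʳ w)))))))) ⟩
          gbin R q L′ N * gbin R q L (N ℕ.+ suc w) * (E′ * pow R q (N ℕ.* (N ℕ.+ suc w)))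
            ≈⟨ solve 4 (λ a b e p → a :* b :* (e :* p) := e :* (p :* a :* b)) refl _ _ _ _ ⟩
          E′ * h N ∎
        evaluate : sumN R (suc L′) h ≈ prev (gbin R q (L′ ℕ.+ L)) (L ∸ w)
        evaluate with ℕP.m≤n⇒m<n∨m≡n w≤L
        ... | inj₁ w<L = trans (gbin-vandermonde-offset q L′ L (suc w) w<L) (≡⇒≈ (≡.cong (prev (gbin R q (L′ ℕ.+ L))) (≡.sym (n∸k≡1+[n∸1+k] w<L))))
        ... | inj₂ ≡.refl = trans (sumN-zero (suc L′) (λ N _ → x*0≈0 (gbin-vanish q (ℕP.m≤n+m (suc L) N))))
                                  (≡⇒≈ (≡.cong (prev (gbin R q (L′ ℕ.+ L))) (≡.sym (ℕP.n∸n≡0 L))))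

    gbin-pair-sum-1 : ∀ {L w} → w ≤ L →
      (1# + pow R q L) * gbin-pair-sum (+ 1) L w ≈ (1# + pow R q w) * s^ (weight (+ 1) (+ w)) * gbin R q (L ℕ.+ L) (L ∸ w)
    gbin-pair-sum-1 {zero}   {zero} z≤n =
      trans (*-congˡ (trans (+-identityˡ _) (trans (*-identityʳ _) (*-identityˡ _)))) (sym (*-identityʳ _))
    gbin-pair-sum-1 {suc L′} {w}    w≤L = begin
      (1# + qL) * gbin-pair-sum (+ 1) L w                     ≈⟨ *-congˡ split ⟩
      (1# + qL) * ((E * x) * B′ + E * A)
        ≈⟨ solve 5 (λ qL E x B′ A → (con 1 :+ qL) :* ((E :* x) :* B′ :+ E :* A) := E :* ((A :+ (qL :* x) :* B′) :+ (x :* B′ :+ qL :* A))) refl qL E x B′ A ⟩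
      E * ((A + (qL * x) * B′) + (x * B′ + qL * A))           ≈⟨ *-congˡ (+-congˡ (+-congˡ (*-congʳ (sym x*qK≈qL)))) ⟩
      E * ((A + (qL * x) * B′) + (x * B′ + (x * qK) * A))
        ≈⟨ *-congˡ (+-congˡ (solve 4 (λ x B′ qK A → x :* B′ :+ (x :* qK) :* A := x :* (B′ :+ qK :* A)) refl x B′ qK A)) ⟩
      E * ((A + (qL * x) * B′) + x * (B′ + qK * A))           ≈⟨ *-congˡ (+-cong (sym pascal′) (*-congˡ (sym (gbin-pascal q n K)))) ⟩
      E * (C + x * C)                                         ≈⟨ solve 3 (λ E x C → E :* (C :+ x :* C) := (con 1 :+ x) :* E :* C) refl E x C ⟩
      (1# + x) * E * C                                        ∎
      where
      L = suc L′
      n = L′ ℕ.+ L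
      K = L ∸ w
      qL = pow R q L
      qK = pow R q K
      x = pow R q w
      E = s^ (weight (+ 1) (+ w))
      A = gbin R q n K
      B′ = prev (gbin R q n) K
      C = gbin R q (suc n) K
      x*qK≈qL : x * qK ≈ qL
      x*qK≈qL = trans (sym (pow-+ q w K)) (≡⇒≈ (≡.cong (pow R q) (ℕP.m+[n∸m]≡n w≤L)))
      pascal′ : C ≈ A + (qL * x) * B′
      pascal′ = trans (gbin-pascal′-prev q n K) (+-congˡ (*-congʳ (trans (≡⇒≈ (≡.cong (pow R q) ([n+n]∸[n∸w]≡n+w w≤L))) (pow-+ q L w))))
      lower upper : ℕ → Carrier
      lower N = prev (gbin R q L′) N * gbin R q L (N ℕ.+ w) * s^ (pair-exponent₁ w N)
      upper N = (pow R q N * gbin R q L′ N) * gbin R q L (N ℕ.+ w) * s^ (pair-exponent₁ w N)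
      split : gbin-pair-sum (+ 1) L w ≈ (E * x) * B′ + E * A
      split = begin
        gbin-pair-sum (+ 1) L w
          ≈⟨ sumN-cong (suc L) (λ N _ → trans (*-congʳ (*-congʳ (gbin-pascal q L′ N)))
                                              (solve 4 (λ a b c d → (a :+ b) :* c :* d := a :* c :* d :+ b :* c :* d) refl _ _ _ _)) ⟩
        sumN R (suc L) (λ N → lower N + upper N)
          ≈⟨ sumN-+ (suc L) lower upper ⟩
        sumN R (suc L) lower + sumN R (suc L) upper
          ≈⟨ +-cong (pair-sum-1-lower L′ w w≤L) (pair-sum-1-upper L′ w w≤L) ⟩
        (E * x) * B′ + E * A ∎

    transform-T : ∀ c L a → transform c L (λ i → T R s t c i a) ≈ gbin-pair-sum c L ℤ.∣ a ∣
    transform-T c L (+ w)    = trans (sumN-cong (suc L) (λ i _ → *-congˡ (T-base-q c i (+ w)))) (transform-Tq c L w)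
    transform-T c L -[1+ u ] = trans (sumN-cong (suc L) (λ i _ → *-congˡ (T-neg c i u))) (transform-Tq c L (suc u))

    T-vanish : ∀ c {i} a → i < ℤ.∣ a ∣ → T R s t c i a ≈ 0#
    T-vanish c {i} (+ w)    i<w = trans (T-base-q c i (+ w)) (Tq-vanish c i<w)
    T-vanish c {i} -[1+ u ] i<w = trans (T-neg c i u) (Tq-vanish c i<w)

    transform-T-0 : ∀ L a →
      sumN R (suc L) (λ i → s^ (+ i ℤ.* + i) * gbin R q L i * T R s t (+ 0) i a) ≈ s^ (a ℤ.* a) * gbinZ R q (2 ℕ.* L) (+ L ℤ.- a)
    transform-T-0 L a = trans (sumN-cong (suc L) (λ i _ → *-congʳ (*-congʳ (s^-cong (square-weight (+ i))))))
                               (trans (transform-T (+ 0) L a) (evaluate (ℕP.≤-<-connex ℤ.∣ a ∣ L)))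
      where
      square-weight : ∀ x → x ℤ.* x ≡ x ℤ.* (x ℤ.- + 0)
      square-weight = ℤ-Solver.solve-∀
      square-∣∣ : ∀ a → weight (+ 0) (+ ℤ.∣ a ∣) ≡ a ℤ.* a
      square-∣∣ (+ w)    = ≡.sym (square-weight (+ w))
      square-∣∣ -[1+ u ] = negate (+ suc u)
        where
        negate : ∀ x → x ℤ.* (x ℤ.- + 0) ≡ (ℤ.- x) ℤ.* (ℤ.- x)
        negate = ℤ-Solver.solve-∀
      evaluate : ℤ.∣ a ∣ ≤ L ⊎ L < ℤ.∣ a ∣ → gbin-pair-sum (+ 0) L ℤ.∣ a ∣ ≈ s^ (a ℤ.* a) * gbinZ R q (2 ℕ.* L) (+ L ℤ.- a)
      evaluate (inj₁ ∣a∣≤L) = trans (gbin-pair-sum-0 ∣a∣≤L) (*-cong (s^-cong (square-∣∣ a)) (sym (gbinZ-2L q L a ∣a∣≤L)))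
      evaluate (inj₂ L<∣a∣) = trans (gbin-pair-sum-vanish (+ 0) L<∣a∣) (sym (x*0≈0 (gbinZ-2L-vanish q L a L<∣a∣)))

    transform-T-1 : ∀ L a →
      (1# + s^ (+ 2 ℤ.* + L)) * transform (+ 1) L (λ i → T R s t (+ 1) i a)
        ≈ (1# + s^ (+ 2 ℤ.* a)) * s^ (a ℤ.* (a ℤ.- + 1)) * gbinZ R q (2 ℕ.* L) (+ L ℤ.- a)
    transform-T-1 L a = trans (*-cong (+-congˡ (sym (pow-q L))) (transform-T (+ 1) L a)) (evaluate (ℕP.≤-<-connex ℤ.∣ a ∣ L))
      where
      coefficient : ∀ a → (1# + pow R q ℤ.∣ a ∣) * s^ (weight (+ 1) (+ ℤ.∣ a ∣)) ≈ (1# + s^ (+ 2 ℤ.* a)) * s^ (a ℤ.* (a ℤ.- + 1))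
      coefficient (+ w)    = *-congʳ (+-congˡ (pow-q w))
      coefficient -[1+ u ] = sym (begin
        (1# + s^ (+ 2 ℤ.* x′)) * s^ (x′ ℤ.* (x′ ℤ.- + 1))                  ≈⟨ *-congˡ (trans (s^-cong (reflect x)) (s^-+ (+ 2 ℤ.* x) (x ℤ.* (x ℤ.- + 1)))) ⟩
        (1# + s^ (+ 2 ℤ.* x′)) * (s^ (+ 2 ℤ.* x) * s^ (x ℤ.* (x ℤ.- + 1)))
          ≈⟨ solve 3 (λ a b c → (con 1 :+ a) :* (b :* c) := (b :+ a :* b) :* c) refl _ _ _ ⟩
        (s^ (+ 2 ℤ.* x) + s^ (+ 2 ℤ.* x′) * s^ (+ 2 ℤ.* x)) * s^ (x ℤ.* (x ℤ.- + 1))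
          ≈⟨ *-congʳ (+-congˡ (trans (sym (s^-+ (+ 2 ℤ.* x′) (+ 2 ℤ.* x))) (s^-cong (cancel x)))) ⟩
        (s^ (+ 2 ℤ.* x) + 1#) * s^ (x ℤ.* (x ℤ.- + 1))                    ≈⟨ *-congʳ (trans (+-comm _ _) (+-congˡ (sym (pow-q (suc u))))) ⟩
        (1# + pow R q (suc u)) * s^ (x ℤ.* (x ℤ.- + 1))                   ∎)
        where
        x = + suc u
        x′ = -[1+ u ]
        reflect : ∀ x → (ℤ.- x) ℤ.* ((ℤ.- x) ℤ.- + 1) ≡ + 2 ℤ.* x ℤ.+ x ℤ.* (x ℤ.- + 1)
        reflect = ℤ-Solver.solve-∀
        cancel : ∀ x → + 2 ℤ.* (ℤ.- x) ℤ.+ + 2 ℤ.* x ≡ + 0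
        cancel = ℤ-Solver.solve-∀
      evaluate : ℤ.∣ a ∣ ≤ L ⊎ L < ℤ.∣ a ∣ →
        (1# + pow R q L) * gbin-pair-sum (+ 1) L ℤ.∣ a ∣ ≈ (1# + s^ (+ 2 ℤ.* a)) * s^ (a ℤ.* (a ℤ.- + 1)) * gbinZ R q (2 ℕ.* L) (+ L ℤ.- a)
      evaluate (inj₁ ∣a∣≤L) = trans (gbin-pair-sum-1 ∣a∣≤L) (*-cong (coefficient a) (sym (gbinZ-2L q L a ∣a∣≤L)))
      evaluate (inj₂ L<∣a∣) = trans (x*0≈0 (gbin-pair-sum-vanish (+ 1) L<∣a∣)) (sym (x*0≈0 (gbinZ-2L-vanish q L a L<∣a∣)))

    ∣-[1+u]+1∣≡u : ∀ u → ℤ.∣ -[1+ u ] ℤ.+ + 1 ∣ ≡ u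
    ∣-[1+u]+1∣≡u zero    = ≡.refl
    ∣-[1+u]+1∣≡u (suc u) = ≡.refl

    transform-T-−1 : ∀ L a →
      transform (ℤ.- + 1) L (λ i → T R s t (ℤ.- + 1) i a + T R s t (ℤ.- + 1) i (a ℤ.+ + 1))
        ≈ s^ (a ℤ.* (a ℤ.+ + 1)) * gbinZ R q (suc (2 ℕ.* L)) (+ L ℤ.- a)
    transform-T-−1 L a = begin
      transform (ℤ.- + 1) L (λ i → T R s t (ℤ.- + 1) i a + T R s t (ℤ.- + 1) i (a ℤ.+ + 1))
        ≈⟨ trans (sumN-cong (suc L) (λ i _ → distribˡ _ _ _)) (sumN-+ (suc L) _ _) ⟩
      transform (ℤ.- + 1) L (λ i → T R s t (ℤ.- + 1) i a) + transform (ℤ.- + 1) L (λ i → T R s t (ℤ.- + 1) i (a ℤ.+ + 1))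
        ≈⟨ +-cong (transform-T (ℤ.- + 1) L a) (transform-T (ℤ.- + 1) L (a ℤ.+ + 1)) ⟩
      Φ ℤ.∣ a ∣ + Φ ℤ.∣ a ℤ.+ + 1 ∣
        ≈⟨ evaluate a ⟩
      s^ (a ℤ.* (a ℤ.+ + 1)) * gbinZ R q (suc (2 ℕ.* L)) (+ L ℤ.- a) ∎
      where
      Φ = gbin-pair-sum (ℤ.- + 1) L
      evaluate : ∀ a → Φ ℤ.∣ a ∣ + Φ ℤ.∣ a ℤ.+ + 1 ∣ ≈ s^ (a ℤ.* (a ℤ.+ + 1)) * gbinZ R q (suc (2 ℕ.* L)) (+ L ℤ.- a)
      evaluate (+ w) with ℕP.≤-<-connex w L
      ... | inj₁ w≤L = trans (+-congˡ (≡⇒≈ (≡.cong Φ (ℕP.+-comm w 1)))) (trans (gbin-pair-sum-−1 w≤L) (*-congˡ (sym (gbinZ-2L+1 q L w w≤L))))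
      ... | inj₂ L<w = trans (+-cong (gbin-pair-sum-vanish (ℤ.- + 1) L<w) (gbin-pair-sum-vanish (ℤ.- + 1) (ℕP.<-≤-trans L<w (ℕP.m≤m+n w 1))))
                             (trans (+-identityˡ 0#) (sym (x*0≈0 (gbinZ-neg q _ L<w))))
      evaluate -[1+ u ] with ℕP.≤-<-connex u L
      ... | inj₁ u≤L = begin
        Φ (suc u) + Φ ℤ.∣ -[1+ u ] ℤ.+ + 1 ∣               ≡⟨ ≡.cong (λ k → Φ (suc u) + Φ k) (∣-[1+u]+1∣≡u u) ⟩
        Φ (suc u) + Φ u                                    ≈⟨ +-comm _ _ ⟩
        Φ u + Φ (suc u)                                    ≈⟨ gbin-pair-sum-−1 u≤L ⟩
        s^ (weight (ℤ.- + 1) (+ u)) * gbin R q (L ℕ.+ suc L) (L ∸ u)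
          ≈⟨ *-cong (s^-cong (reflect (+ u))) (sym (gbinZ-2L+1-neg q L u u≤L)) ⟩
        s^ (-[1+ u ] ℤ.* (-[1+ u ] ℤ.+ + 1)) * gbinZ R q (suc (2 ℕ.* L)) (+ L ℤ.- -[1+ u ]) ∎
        where
        reflect : ∀ x → x ℤ.* (x ℤ.+ + 1) ≡ (ℤ.- (+ 1 ℤ.+ x)) ℤ.* ((ℤ.- (+ 1 ℤ.+ x)) ℤ.+ + 1)
        reflect = ℤ-Solver.solve-∀
      ... | inj₂ L<u = trans (+-cong (gbin-pair-sum-vanish (ℤ.- + 1) (ℕP.m<n⇒m<1+n L<u))
                                     (gbin-pair-sum-vanish (ℤ.- + 1) (≡.subst (L <_) (≡.sym (∣-[1+u]+1∣≡u u)) L<u)))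
                             (trans (+-identityˡ 0#) (sym (x*0≈0 (gbin-vanish q
                               (≡.subst (ℕ._< L ℕ.+ suc u) (≡.sym (1+2*n≡n+[1+n] L)) (ℕP.+-monoʳ-< L (s≤s L<u)))))))

    identity₀ : (α : ℤ → Carrier) (F : ℕ → Carrier) →
      (∀ L → F L ≈ sumZ R (suc L) (λ a → α a * T R s t (+ 0) L a)) →
      ∀ L → sumN R (suc L) (λ i → s^ (+ i ℤ.* + i) * gbin R q L i * F i)
              ≈ sumZ R (suc L) (λ a → α a * s^ (a ℤ.* a) * gbinZ R q (2 ℕ.* L) (+ L ℤ.- a))
    identity₀ α F F≈ L =
      trans (sumN-sumZ-exchange L _ (T R s t (+ 0)) α F F≈ (λ i a 1+i<∣a∣ → T-vanish (+ 0) a (ℕP.<-trans (ℕP.n<1+n i) 1+i<∣a∣)))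
            (sumN-cong (suc (suc L ℕ.+ suc L)) (λ j _ → trans (*-congˡ (transform-T-0 L (+ j ℤ.- + suc L))) (sym (*-assoc _ _ _))))

    identity₁ : (α : ℤ → Carrier) (F : ℕ → Carrier) →
      (∀ L → F L ≈ sumZ R (suc L) (λ a → α a * T R s t (+ 1) L a)) →
      ∀ L → (1# + s^ (+ 2 ℤ.* + L)) * transform (+ 1) L F
              ≈ sumZ R (suc L) (λ a → α a * (1# + s^ (+ 2 ℤ.* a)) * s^ (a ℤ.* (a ℤ.- + 1)) * gbinZ R q (2 ℕ.* L) (+ L ℤ.- a))
    identity₁ α F F≈ L =
      trans (*-congˡ (sumN-sumZ-exchange L _ (T R s t (+ 1)) α F F≈ (λ i a 1+i<∣a∣ → T-vanish (+ 1) a (ℕP.<-trans (ℕP.n<1+n i) 1+i<∣a∣))))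
            (trans (sumN-*ˡ M _ _) (sumN-cong M (λ j _ → term (+ j ℤ.- + suc L))))
      where
      M = suc (suc L ℕ.+ suc L)
      x = 1# + s^ (+ 2 ℤ.* + L)
      term : ∀ a → x * (α a * transform (+ 1) L (λ i → T R s t (+ 1) i a))
                 ≈ α a * (1# + s^ (+ 2 ℤ.* a)) * s^ (a ℤ.* (a ℤ.- + 1)) * gbinZ R q (2 ℕ.* L) (+ L ℤ.- a)
      term a = begin
        x * (α a * transform (+ 1) L (λ i → T R s t (+ 1) i a))    ≈⟨ solve 3 (λ x a y → x :* (a :* y) := a :* (x :* y)) refl x (α a) _ ⟩
        α a * (x * transform (+ 1) L (λ i → T R s t (+ 1) i a))    ≈⟨ *-congˡ (transform-T-1 L a) ⟩
        α a * ((1# + s^ (+ 2 ℤ.* a)) * s^ (a ℤ.* (a ℤ.- + 1)) * gbinZ R q (2 ℕ.* L) (+ L ℤ.- a))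
          ≈⟨ solve 4 (λ a b c d → a :* (b :* c :* d) := a :* b :* c :* d) refl (α a) _ _ _ ⟩
        α a * (1# + s^ (+ 2 ℤ.* a)) * s^ (a ℤ.* (a ℤ.- + 1)) * gbinZ R q (2 ℕ.* L) (+ L ℤ.- a) ∎

    identity₋₁ : (α : ℤ → Carrier) (F : ℕ → Carrier) →
      (∀ L → F L ≈ sumZ R (suc L) (λ a → α a * (T R s t (ℤ.- + 1) L a + T R s t (ℤ.- + 1) L (a ℤ.+ + 1)))) →
      ∀ L → transform (ℤ.- + 1) L F ≈ sumZ R (suc L) (λ a → α a * s^ (a ℤ.* (a ℤ.+ + 1)) * gbinZ R q (suc (2 ℕ.* L)) (+ L ℤ.- a))
    identity₋₁ α F F≈ L =
      trans (sumN-sumZ-exchange L _ K α F F≈ K-vanish)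
            (sumN-cong (suc (suc L ℕ.+ suc L)) (λ j _ → trans (*-congˡ (transform-T-−1 L (+ j ℤ.- + suc L))) (sym (*-assoc _ _ _))))
      where
      K : ℕ → ℤ → Carrier
      K i a = T R s t (ℤ.- + 1) i a + T R s t (ℤ.- + 1) i (a ℤ.+ + 1)
      i<∣a+1∣ : ∀ {i} a → suc i < ℤ.∣ a ∣ → i < ℤ.∣ a ℤ.+ + 1 ∣
      i<∣a+1∣ {i} (+ w)    1+i<w     = ℕP.<-≤-trans (ℕP.<-trans (ℕP.n<1+n i) 1+i<w) (ℕP.m≤m+n w 1)
      i<∣a+1∣ {i} -[1+ u ] (s≤s i<u) = ≡.subst (i <_) (≡.sym (∣-[1+u]+1∣≡u u)) i<u
      K-vanish : ∀ i a → suc i < ℤ.∣ a ∣ → K i a ≈ 0#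
      K-vanish i a 1+i<∣a∣ = trans (+-cong (T-vanish (ℤ.- + 1) a (ℕP.<-trans (ℕP.n<1+n i) 1+i<∣a∣))
                                           (T-vanish (ℤ.- + 1) (a ℤ.+ + 1) (i<∣a+1∣ a 1+i<∣a∣)))
                                   (+-identityˡ 0#)

theorem3p5 : {c ℓ : Level} (R : CommutativeRing c ℓ) →
    let open CommutativeRing R in
    (s t : Carrier) → s * t ≈ 1# →
    (α₀ α₁ α₋₁ : ℤ → Carrier) (F₀ F₁ F₋₁ : ℕ → Carrier) →
    (∀ L → F₀ L ≈ sumZ R (suc L) (λ a → α₀ a * T R s t (+ 0) L a)) →
    (∀ L → F₁ L ≈ sumZ R (suc L) (λ a → α₁ a * T R s t (+ 1) L a)) →
    (∀ L → F₋₁ L ≈ sumZ R (suc L) (λ a → α₋₁ a * (T R s t (ℤ.- (+ 1)) L a + T R s t (ℤ.- (+ 1)) L (a ℤ.+ (+ 1))))) →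
    (∀ L →
      sumN R (suc L) (λ i → spow R s t ((+ i) ℤ.* (+ i)) * gbin R (qpow R s t (+ 1)) L i * F₀ i)
        ≈ sumZ R (suc L) (λ a → α₀ a * spow R s t (a ℤ.* a) * gbinZ R (qpow R s t (+ 1)) (2 ℕ.* L) ((+ L) ℤ.- a)))
    × (∀ L →
      (1# + qpow R s t (+ L)) * sumN R (suc L) (λ i → spow R s t ((+ i) ℤ.* ((+ i) ℤ.- (+ 1))) * gbin R (qpow R s t (+ 1)) L i * F₁ i)
        ≈ sumZ R (suc L) (λ a → α₁ a * (1# + qpow R s t a) * spow R s t (a ℤ.* (a ℤ.- (+ 1))) * gbinZ R (qpow R s t (+ 1)) (2 ℕ.* L) ((+ L) ℤ.- a)))
    × (∀ L →
      sumN R (suc L) (λ i → spow R s t ((+ i) ℤ.* ((+ i) ℤ.+ (+ 1))) * gbin R (qpow R s t (+ 1)) L i * F₋₁ i)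
        ≈ sumZ R (suc L) (λ a → α₋₁ a * spow R s t (a ℤ.* (a ℤ.+ (+ 1))) * gbinZ R (qpow R s t (+ 1)) (suc (2 ℕ.* L)) ((+ L) ℤ.- a)))
theorem3p5 R s t s*t≈1 α₀ α₁ α₋₁ F₀ F₁ F₋₁ F₀≈ F₁≈ F₋₁≈ =
  identity₀ R s t s*t≈1 α₀ F₀ F₀≈ , identity₁ R s t s*t≈1 α₁ F₁ F₁≈ , identity₋₁ R s t s*t≈1 α₋₁ F₋₁ F₋₁≈
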